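{- Let $\mathcal T$ be a triangulation of the punctured disc $S_\odot$ and let $i,j\in\{1,\dots,N\}$ be boundary vertices with $j\neq i+1$ (the case $j=i$ is allowed). (1) If $D_{ij}\in\mathcal T$, then $m_{ij}=1$. (2) If $D_{i0}\in\mathcal T$, then $m_{i0}=1$.
   Context: Let $N\ge 3$ and let $S_\odot$ be a closed disc with $N$ marked points on its boundary, labelled $1,\dots,N$ in clockwise order (labels are taken modulo $N$), and one marked point $0$ (the puncture) in its interior. For boundary vertices $k,l$ let $B_{kl}$ be the boundary path going clockwise from $k$ to $l$ ($B_{kk}$ is the whole boundary starting and ending at $k$), and let $V_{kl}$ be the set of marked points on $B_{kl}$, i.e. $\{k,k+1,\dots,l\}$ modulo $N$. Arcs are taken up to isotopy relative to the marked points; they do not self-intersect, their interiors avoid the boundary and the marked points, and they do not cut out an unpunctured monogon or digon. They are: for boundary vertices $i,j$ with $j\ne i+1$ (possibly $j=i$), the arc $D_{ij}$ from $i$ to $j$ which together with $B_{ij}$ bounds a disc not containing the puncture (for $i=j$, $D_{ii}$ is the loop based at $i$ enclosing the puncture; for $i\neq j$, $D_{ij}\ne D_{ji}$); and, for each boundary vertex $i$, the central arc $D_{i0}$ from $i$ to the puncture. A triangulation $\mathcal T$ is a maximal collection of pairwise non-crossing arcs; it cuts $S_\odot$ into $N$ triangles, one of which may be self-folded (with sides $D_{i0}$ and $D_{ii}$; this happens exactly when $D_{i0}$ is the only central arc in $\mathcal T$). A triangle (or a piece of a triangle) is incident with a marked point if that point is one of its corners (and lies on the closure of the piece). For a set $I$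 of marked points and a finite set $R$ of such regions, a matching between $I$ and $R$ is an injective map $I\to R$ sending each $p\in I$ to a region incident with $p$; $\mathcal M(I,R)$ denotes the set of these. Truncation: for boundary vertices $i\ne j$, $j\ne i+1$, let $S_{ij}$ be the unpunctured disc bounded by $D_{ij}$ and $B_{ij}$ (marked points $V_{ij}$), and let $\mathcal T|_{S_{ij}}$ be the set of connected components of the intersections of the triangles of $\mathcal T$ with $S_{ij}$ (a triangle crossed by $D_{ij}$ may give two separate pieces, each counted as its own region), a piece being incident with those corners of its triangle lying in $V_{ij}$ on its closure. The disc $P(i)$: if $\mathcal T$ has at least two central arcs, let $k$ be the first boundary vertex reached going anticlockwise from $i$, starting with $i$ itself, such that $D_{k0}\in\mathcal T$, and $j$ the first boundary vertex strictly clockwise from $i$ with $D_{j0}\in\mathcal T$; then $P(i)$ is the unpunctured disc bounded by $B_{kj}$, $D_{j0}$, $D_{k0}$, with marked points $V_{kj}\cup\{0\}$, triangulated by the triangles of $\mathcal T$ inside it. If $\mathcal T$ has exactly one central arc $D_{k0}$ ($k$ possibly equal to $i$), $P(i)$ is the unpunctured disc obtained by cutting $S_\odot$ open along $D_{k0}$; its marked points in clockwise order are $k',k+1,\dots,k-1,k,0$ where $k',k$ are the two copies of $k$, triangulated by the triangles of $\mathcal T$ (the self-folded triangle becoming a triangle with corners $k,0,k'$). Matching numbers: $m_{i,i+1}=1$; for $i\neq j$, $j\ne i+1$: $m_{ij}=|\mathcal M(V_{i+1,j-1},\mathcal T|_{S_{ij}})|$; $m_{ii}=|\mathcal M((\{1,\dots,N\}\setminus\{i\})\cup\{0\},\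 \text{triangles of }\mathcal T)|$ (each triangle of $\mathcal T$ counts as a single region); $m_{i0}=|\mathcal M(V(P(i))\setminus\{i,0\},\ \text{triangles of }P(i))|$, where $V(P(i))$ is the set of marked points of $P(i)$. -}

module Defs where

-- Combinatorial model of triangulations of the once-punctured disc S_⊙
-- with N boundary marked points, via its universal cover.
--
-- Conventions:
--  * Boundary vertex with paper-label k (1 ≤ k ≤ N) is  Fin N  element k-1;
--    clockwise order = increasing index (mod N).
--  * Universal cover: boundary marked points become the natural numbers
--    (position x lies over the vertex  x mod N), the puncture becomes a
--    single ideal point ∞ ("punct").  The arc D_ij (j ≠ i+1) lifts to the
--    chords  [i + sN , i + len i j + sN]  where len i j ∈ {2,…,N} is the
--    clockwise distance from i to j (len i i = N : the loop D_ii);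
--    the central arc D_i0 lifts to the rays from  i + sN  to ∞.

open import Data.Nat using (ℕ; zero; suc; _+_; _*_; _∸_; _<_; _≤_; _%_; NonZero; _≤ᵇ_; _<ᵇ_; _≡ᵇ_)
open import Data.Nat.DivMod using (m%n<n)
open import Data.Fin using (Fin; toℕ; fromℕ<; _≟_)
open import Data.Bool using (Bool; true; false; _∧_; _∨_; not; if_then_else_)
open import Data.List using (List; []; _∷_; map; filter; filterᵇ; upTo; concatMap; allFin; _++_)
open import Data.Nat.ListAction using (sum)
open import Data.Bool.ListAction using (any; all)
open import Data.Maybe using (Maybe; just; nothing)
open import Data.Product using (_×_; _,_; ∃₂)
open import Data.Sum using (_⊎_)
open import Data.Empty using (⊥)
open import Data.Unit using (⊤)
open import Relation.Nullary using (¬_; does)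
open import Relation.Binary.PropositionalEquality using (_≡_; _≢_)

-- Arcs of S_⊙ (dArc i j is D_ij, only meaningful for j ≠ i+1; cArc i is D_i0).
data Arc (N : ℕ) : Set where
  dArc : Fin N → Fin N → Arc N
  cArc : Fin N → Arc N

-- Generic counting of matchings.
-- A region is given by the list of marked points it is incident with;
-- regions are distinguished by their position in the list.
data Pt : Set where
  pos   : ℕ → Pt      -- a boundary marked point (a label, or a position in the cover)
  punct : Pt

eqPt : Pt → Pt → Bool
eqPt (pos m) (pos n) = m ≡ᵇ n
eqPt punct punct = true
eqPt _ _ = false

elemPt : Pt → List Pt → Bool
elemPt p xs = any (eqPt p) xs

picks : {A : Set} → List A → List (A × List A)
picks [] = []
picks (x ∷ xs) = (x , xs) ∷ map (λ { (y , ys) → (y , x ∷ ys) }) (picks xs)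

-- matchCount I R = |M(I,R)| = number of injective maps I → R sending each
-- p ∈ I to a region incident with p (I given as a duplicate-free list).
matchCount : List Pt → List (List Pt) → ℕ
matchCount [] R = 1
matchCount (p ∷ ps) R =
  sum (map (λ { (r , rest) → if elemPt p r then matchCount ps rest else 0 }) (picks R))

range : ℕ → ℕ → List ℕ
range a b = map (a +_) (upTo (b ∸ a))

-- lifted triangles in the cover: finite (x<y<z) or with the ideal vertex ∞ (x<y)
data LTri : Set where
  fin : ℕ → ℕ → ℕ → LTri
  inf : ℕ → ℕ → LTri

module _ (N : ℕ) {{_ : NonZero N}} where

  lab : ℕ → Fin N
  lab x = fromℕ< (m%n<n x N)

  next : Fin N → Fin N
  next i = lab (suc (toℕ i))

  len : Fin N → Fin N → ℕ
  len i j with (toℕ j + N ∸ toℕ i) % N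
  ... | zero = N
  ... | suc d = suc d

  ValidArc : Arc N → Set
  ValidArc (dArc i j) = j ≢ next i
  ValidArc (cArc i) = ⊤

  Interleave : ℕ → ℕ → ℕ → ℕ → Set
  Interleave p q r u = (p < r × r < q × q < u) ⊎ (r < p × p < u × u < q)

  -- two arcs cross iff some of their lifts to the universal cover cross
  Cross : Arc N → Arc N → Set
  Cross (dArc i j) (dArc k l) = ∃₂ λ s t →
    Interleave (toℕ i + s * N) (toℕ i + len i j + s * N) (toℕ k + t * N) (toℕ k + len k l + t * N)
  Cross (dArc i j) (cArc k) = ∃₂ λ s t →
    (toℕ i + s * N < toℕ k + t * N) × (toℕ k + t * N < toℕ i + len i j + s * N)
  Cross (cArc k) (dArc i j) = ∃₂ λ s t →
    (toℕ i + s * N < toℕ k + t * N) × (toℕ k + t * N < toℕ i + len i j + s * N)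
  Cross (cArc _) (cArc _) = ⊥

  record IsTriangulation (T : Arc N → Bool) : Set where
    field
      valid       : ∀ a → T a ≡ true → ValidArc a
      nonCrossing : ∀ a b → T a ≡ true → T b ≡ true → ¬ Cross a b
      maximal     : ∀ a → ValidArc a → (∀ b → T b ≡ true → ¬ Cross a b) → T a ≡ true

  module _ (T : Arc N → Bool) where

    -- x < y joined by a boundary segment or by a lift of an arc of T
    Edge : ℕ → ℕ → Bool
    Edge x y = (suc x ≡ᵇ y) ∨ ((x <ᵇ y) ∧ (2 ≤ᵇ (y ∸ x)) ∧ ((y ∸ x) ≤ᵇ N) ∧ T (dArc (lab x) (lab y)))

    -- the lift of a central arc of T from position v to ∞
    Ray : ℕ → Bool
    Ray v = T (cArc (lab v))

    isTri : LTri → Bool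
    isTri (fin x y z) = (x <ᵇ y) ∧ (y <ᵇ z) ∧ Edge x y ∧ Edge y z ∧ Edge x z
    isTri (inf x y) = (x <ᵇ y) ∧ Edge x y ∧ Ray x ∧ Ray y

    liftTris : ℕ → List LTri
    liftTris bound = filterᵇ (λ t → isTri t)
      (concatMap (λ x → concatMap (λ y → inf x y ∷ map (fin x y) (range (suc y) (suc (x + N))))
                                   (range (suc x) (suc (x + N))))
                 (upTo bound))

    -- triangles of T: one lift per triangle (least vertex in [0,N))
    trisT : List LTri
    trisT = liftTris N

    labCorners : LTri → List Pt
    labCorners (fin x y z) = pos (x % N) ∷ pos (y % N) ∷ pos (z % N) ∷ []
    labCorners (inf x y) = pos (x % N) ∷ pos (y % N) ∷ punct ∷ []

    finVerts : LTri → List ℕ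
    finVerts (fin x y z) = x ∷ y ∷ z ∷ []
    finVerts (inf x y) = x ∷ y ∷ []

    inI : ℕ → ℕ → ℕ → Bool
    inI a b v = (a ≤ᵇ v) ∧ (v ≤ᵇ b)

    crossChord : ℕ → ℕ → ℕ → ℕ → Bool
    crossChord a b u v = ((a <ᵇ u) ∧ (u <ᵇ b) ∧ (b <ᵇ v)) ∨ ((u <ᵇ a) ∧ (a <ᵇ v) ∧ (v <ᵇ b))

    -- the lifted triangle meets the region U under the chord [a,b] (the lift of
    -- S_ij) in a set with nonempty interior: it lies in U, or one of its sides
    -- crosses the chord
    meets : ℕ → ℕ → LTri → Bool
    meets a b (fin x y z) = (inI a b x ∧ inI a b y ∧ inI a b z)
      ∨ crossChord a b x y ∨ crossChord a b y z ∨ crossChord a b x z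
    meets a b (inf x y) = crossChord a b x y ∨ ((a <ᵇ x) ∧ (x <ᵇ b)) ∨ ((a <ᵇ y) ∧ (y <ᵇ b))

    piecePts : ℕ → ℕ → LTri → List Pt
    piecePts a b t = map pos (filterᵇ (λ v → inI a b v) (finVerts t))

    -- m_ij for i ≠ j, j ≠ i+1: the lift of S_ij is the region under [a, a + len i j]
    mTrunc : Fin N → Fin N → ℕ
    mTrunc i j =
      let a = toℕ i + N
          b = a + len i j
      in matchCount (map pos (range (suc a) b))
                    (map (piecePts a b) (filterᵇ (λ t → meets a b t) (liftTris (4 * N))))

    mLoop : Fin N → ℕ
    mLoop i = matchCount (map (λ k → pos (toℕ k)) (filter (λ k → Relation.Nullary.¬? (k ≟ i)) (allFin N)) ++ punct ∷ [])
                         (map labCorners trisT)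

    m : Fin N → Fin N → ℕ
    m i j with does (i ≟ j) | does (j ≟ next i)
    ... | true  | _     = mLoop i
    ... | false | true  = 1
    ... | false | false = mTrunc i j

    searchDown : ℕ → ℕ → Maybe ℕ
    searchDown p zero = nothing
    searchDown p (suc k) = if Ray p then just p else searchDown (p ∸ 1) k

    searchUp : ℕ → ℕ → Maybe ℕ
    searchUp p zero = nothing
    searchUp p (suc k) = if Ray p then just p else searchUp (suc p) k

    posCorners : LTri → List Pt
    posCorners (fin x y z) = pos x ∷ pos y ∷ pos z ∷ []
    posCorners (inf x y) = pos x ∷ pos y ∷ punct ∷ []

    allIn : ℕ → ℕ → LTri → Bool
    allIn r1 r2 t = all (inI r1 r2) (finVerts t)

    -- With p the lift of i, P(i) lifts to the region between the rays at
    -- r1 (largest ≤ p) and r2 (least > p); its marked points are the positions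
    -- r1,…,r2 and ∞.  (If T had no central arc, the value is irrelevant: 0.)
    m0 : Fin N → ℕ
    m0 i with searchDown (toℕ i + N) N | searchUp (suc (toℕ i + N)) N
    ... | just r1 | just r2 =
          matchCount (map pos (filterᵇ (λ v → not (v ≡ᵇ (toℕ i + N))) (range r1 (suc r2))))
                     (map posCorners (filterᵇ (allIn r1 r2) (liftTris (4 * N))))
    ... | _ | _ = 0

-- Work in the universal cover of the disc minus the puncture: boundary marked
-- points become ℕ, arcs of T become chords and central arcs become rays to the
-- ideal point ∞.  In each case the surface to be matched (S_ij, P(i), or the
-- disc cut open along D_i0 when D_ii ∈ T) lifts to a polygon under one chord,
-- triangulated by lifted triangles.  Every marked point v strictly inside the
-- polygon is the middle vertex of exactly one of its triangles (x, v, z), its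
-- owner, and any other triangle with corner v has v as an end and is strictly
-- narrower (smaller z − x); the last point, resp. the puncture, owns the
-- triangle with the ideal vertex.  So the narrowest owner is the only region
-- containing its point, every matching must pair them, and induction shows the
-- matching sending each point to its owner is the only one.

module Submission where

open import Defs
import Data.Bool as 𝔹
open import Data.Bool using (Bool; true; false; _∧_; _∨_; if_then_else_)
open import Data.Empty using (⊥)
open import Data.Fin as Fin using (Fin; toℕ)
open import Data.Fin.Properties using (toℕ-fromℕ<; toℕ-injective; toℕ<n)
open import Data.List using (List; []; _∷_; _++_; map; filter; filterᵇ; concatMap; upTo; allFin; length)
open import Data.List.Extrema.Nat using (argmin; argmin-all; f[argmin]≤f[xs])
open import Data.List.Membership.Propositional using (_∈_; _∉_; find; lose)
open import Data.List.Membership.Propositional.Properties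
  using (∈-∃++; ∈-map⁺; ∈-map⁻; ∈-filter⁺; ∈-filter⁻; ∈-++⁻; ∈-++⁺ˡ; ∈-++⁺ʳ; ∈-allFin; ∈-concatMap⁺; ∈-concatMap⁻; ∈-upTo⁺; ∈-upTo⁻)
open import Data.List.Properties using (map-cong; map-∘; map-++)
import Data.List.Relation.Binary.Permutation.Propositional as ↭
open import Data.List.Relation.Binary.Permutation.Propositional using (_↭_; ↭-sym; ↭⇒↭ₛ)
open import Data.List.Relation.Binary.Permutation.Propositional.Properties using (shift; ∈-resp-↭; ↭-length)
open import Data.List.Relation.Binary.Permutation.Setoid.Properties using (Unique-resp-↭)
import Data.List.Relation.Unary.All as All
open import Data.List.Relation.Unary.All using (All; []; _∷_; lookup; tabulate)
open import Data.List.Relation.Unary.Any as Any using (here; there)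
open import Data.List.Relation.Unary.Unique.Propositional using (Unique; []; _∷_)
import Data.List.Relation.Unary.Unique.Propositional.Properties as Unique
open import Data.Maybe using (just)
open import Data.Nat using (ℕ; zero; suc; _+_; _*_; _∸_; _<_; _≤_; _%_; _/_; NonZero; z≤n; s≤s; z<s; _<?_; _≤ᵇ_; _<ᵇ_; _≡ᵇ_; >-nonZero⁻¹)
open import Data.Nat.DivMod using (m≡m%n+[m/n]*n; [m+kn]%n≡m%n; [m+n]%n≡m%n; m<n⇒m%n≡m; m%n<n; n%n≡0; %-distribˡ-+; m%n%n≡m%n)
open import Data.Nat.ListAction using (sum)
open import Data.Nat.Properties
open import Data.Product using (∃; _×_; _,_; proj₁; proj₂)
open import Data.Sum using (_⊎_; inj₁; inj₂)
open import Data.Unit using (tt)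
open import Function using (_∘_)
open import Relation.Binary using (tri<; tri≈; tri>)
open import Relation.Binary.PropositionalEquality
  using (_≡_; _≢_; refl; sym; trans; cong; cong₂; subst; subst₂; setoid; module ≡-Reasoning)
open import Relation.Nullary using (¬_; ¬?; Dec; yes; no; contradiction; T?)
open import Algebra.Properties.CommutativeSemigroup +-commutativeSemigroup using (interchange; x∙yz≈y∙xz)

pos-injective : ∀ {m n} → pos m ≡ pos n → m ≡ n
pos-injective refl = refl

_≟Pt_ : (p q : Pt) → Dec (p ≡ q)
pos m ≟Pt pos n with m ≟ n
... | yes refl = yes refl
... | no m≢n = no λ { refl → m≢n refl }
pos _ ≟Pt punct = no λ ()
punct ≟Pt pos _ = no λ ()
punct ≟Pt punct = yes refl

eqPt⇒≡ : ∀ p q → eqPt p q ≡ true → p ≡ q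
eqPt⇒≡ (pos m) (pos n) e = cong pos (≡ᵇ⇒≡ m n (subst 𝔹.T (sym e) _))
eqPt⇒≡ punct punct _ = refl

eqPt-refl : ∀ p → eqPt p p ≡ true
eqPt-refl (pos m) with m ≡ᵇ m | ≡⇒≡ᵇ m m refl
... | true | _ = refl
eqPt-refl punct = refl

elemPt⇒∈ : ∀ p r → elemPt p r ≡ true → p ∈ r
elemPt⇒∈ p (q ∷ r) e with eqPt p q in p≈q
... | true = here (eqPt⇒≡ p q p≈q)
... | false = there (elemPt⇒∈ p r e)

∈⇒elemPt : ∀ p r → p ∈ r → elemPt p r ≡ true
∈⇒elemPt p (q ∷ r) (here refl) rewrite eqPt-refl p = refl
∈⇒elemPt p (q ∷ r) (there p∈r) with eqPt p q
... | true = refl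
... | false = ∈⇒elemPt p r p∈r

∉⇒elemPt : ∀ p r → p ∉ r → elemPt p r ≡ false
∉⇒elemPt p r p∉r with elemPt p r in e
... | true = contradiction (elemPt⇒∈ p r e) p∉r
... | false = refl

sum-cong : {A : Set} (f g : A → ℕ) (xs : List A) → (∀ x → f x ≡ g x) → sum (map f xs) ≡ sum (map g xs)
sum-cong f g xs f≗g = cong sum (map-cong f≗g xs)

sum-+ : {A : Set} (f g : A → ℕ) (xs : List A) →
  sum (map (λ x → f x + g x) xs) ≡ sum (map f xs) + sum (map g xs)
sum-+ f g [] = refl
sum-+ f g (x ∷ xs) = trans (cong (f x + g x +_) (sum-+ f g xs)) (interchange (f x) (g x) _ _)

sum-if : {A : Set} (b : Bool) (f : A → ℕ) (xs : List A) →
  (if b then sum (map f xs) else 0) ≡ sum (map (λ x → if b then f x else 0) xs)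
sum-if true f xs = refl
sum-if false f [] = refl
sum-if false f (x ∷ xs) = sum-if false f xs

module _ {A : Set} where

  sum-picks-∷ : (h : A × List A → ℕ) (x : A) (xs : List A) →
    sum (map h (picks (x ∷ xs))) ≡ h (x , xs) + sum (map (λ q → h (proj₁ q , x ∷ proj₂ q)) (picks xs))
  sum-picks-∷ h x xs = cong (λ l → h (x , xs) + sum l) (sym (map-∘ (picks xs)))

  sumPairs : (A → A → List A → ℕ) → List A → ℕ
  sumPairs g R = sum (map (λ q → sum (map (λ q' → g (proj₁ q) (proj₁ q') (proj₂ q')) (picks (proj₂ q)))) (picks R))

  sumPairs-cong : ∀ g h R → (∀ a b l → g a b l ≡ h a b l) → sumPairs g R ≡ sumPairs h R
  sumPairs-cong g h R g≗h = sum-cong _ _ (picks R) (λ q → sum-cong _ _ (picks (proj₂ q)) (λ q' → g≗h _ _ _))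

  sumPairs-∷ : ∀ g x xs → sumPairs g (x ∷ xs) ≡
    sum (map (λ q → g x (proj₁ q) (proj₂ q)) (picks xs)) +
    (sum (map (λ q → g (proj₁ q) x (proj₂ q)) (picks xs)) + sumPairs (λ a b l → g a b (x ∷ l)) xs)
  sumPairs-∷ g x xs =
    trans (sum-picks-∷ _ x xs)
      (cong (sum (map (λ q → g x (proj₁ q) (proj₂ q)) (picks xs)) +_)
        (trans (sum-cong _ _ (picks xs) (λ q → sum-picks-∷ (λ q′ → g (proj₁ q) (proj₁ q′) (proj₂ q′)) x (proj₂ q)))
                 (sum-+ (λ q → g (proj₁ q) x (proj₂ q)) (λ q → sum (map (λ q′ → g (proj₁ q) (proj₁ q′) (x ∷ proj₂ q′)) (picks (proj₂ q)))) (picks xs))))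

  sumPairs-swap : ∀ g R → sumPairs g R ≡ sumPairs (λ a b l → g b a l) R
  sumPairs-swap g [] = refl
  sumPairs-swap g (x ∷ xs) = begin
    sumPairs g (x ∷ xs)
      ≡⟨ sumPairs-∷ g x xs ⟩
    first + (second + sumPairs (λ a b l → g a b (x ∷ l)) xs)
      ≡⟨ cong (λ s → first + (second + s)) (sumPairs-swap (λ a b l → g a b (x ∷ l)) xs) ⟩
    first + (second + sumPairs (λ a b l → g b a (x ∷ l)) xs)
      ≡⟨ x∙yz≈y∙xz first second _ ⟩
    second + (first + sumPairs (λ a b l → g b a (x ∷ l)) xs)
      ≡⟨ sumPairs-∷ (λ a b l → g b a l) x xs ⟨
    sumPairs (λ a b l → g b a l) (x ∷ xs) ∎
    where
    open ≡-Reasoning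
    first = sum (map (λ q → g x (proj₁ q) (proj₂ q)) (picks xs))
    second = sum (map (λ q → g (proj₁ q) x (proj₂ q)) (picks xs))

if-if-comm : (b c : Bool) (n : ℕ) → (if b then (if c then n else 0) else 0) ≡ (if c then (if b then n else 0) else 0)
if-if-comm true true n = refl
if-if-comm true false n = refl
if-if-comm false true n = refl
if-if-comm false false n = refl

matchCount-swap : ∀ p q I R → matchCount (p ∷ q ∷ I) R ≡ matchCount (q ∷ p ∷ I) R
matchCount-swap p q I R =
  trans (sum-cong _ _ (picks R) (λ r → sum-if (elemPt p (proj₁ r)) _ (picks (proj₂ r))))
  (trans (sumPairs-swap (λ a b l → if elemPt p a then (if elemPt q b then matchCount I l else 0) else 0) R)
  (trans (sumPairs-cong _ _ R (λ a b l → if-if-comm (elemPt p b) (elemPt q a) _))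
   (sym (sum-cong _ _ (picks R) (λ r → sum-if (elemPt q (proj₁ r)) _ (picks (proj₂ r)))))))

matchCount-↭ : ∀ {I J} → I ↭ J → ∀ R → matchCount I R ≡ matchCount J R
matchCount-↭ ↭.refl R = refl
matchCount-↭ (↭.prep x I↭J) R =
  sum-cong _ _ (picks R) (λ q → cong (if elemPt x (proj₁ q) then_else 0) (matchCount-↭ I↭J (proj₂ q)))
matchCount-↭ {x ∷ y ∷ I} (↭.swap x y I↭J) R =
  trans (matchCount-swap x y I R)
   (sum-cong _ _ (picks R) (λ q → cong (if elemPt y (proj₁ q) then_else 0)
     (sum-cong _ _ (picks (proj₂ q)) (λ q' → cong (if elemPt x (proj₁ q') then_else 0) (matchCount-↭ I↭J (proj₂ q'))))))
matchCount-↭ (↭.trans I↭J J↭K) R = trans (matchCount-↭ I↭J R) (matchCount-↭ J↭K R)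

-- matchCount (y ∷ I) R unfolds to choices y (matchCount I) R
choices : Pt → (List (List Pt) → ℕ) → List (List Pt) → ℕ
choices y h R = sum (map (λ q → if elemPt y (proj₁ q) then h (proj₂ q) else 0) (picks R))

choices-∷ : ∀ y h r R → choices y h (r ∷ R) ≡ (if elemPt y r then h R else 0) + choices y (λ l → h (r ∷ l)) R
choices-∷ y h r R = sum-picks-∷ _ r R

choices-∉ : ∀ y h R → All (y ∉_) R → choices y h R ≡ 0
choices-∉ y h [] [] = refl
choices-∉ y h (r ∷ R) (y∉r ∷ y∉R) rewrite choices-∷ y h r R | ∉⇒elemPt y r y∉r = choices-∉ y _ R y∉R

choices-single : ∀ y h R₁ r R₂ → y ∈ r → All (y ∉_) R₁ → All (y ∉_) R₂ → choices y h (R₁ ++ r ∷ R₂) ≡ h (R₁ ++ R₂)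
choices-single y h [] r R₂ y∈r _ y∉R₂ rewrite choices-∷ y h r R₂ | ∈⇒elemPt y r y∈r | choices-∉ y (λ l → h (r ∷ l)) R₂ y∉R₂ =
  +-identityʳ (h R₂)
choices-single y h (r′ ∷ R₁) r R₂ y∈r (y∉r′ ∷ y∉R₁) y∉R₂ rewrite choices-∷ y h r′ (R₁ ++ r ∷ R₂) | ∉⇒elemPt y r′ y∉r′ =
  choices-single y (λ l → h (r′ ∷ l)) R₁ r R₂ y∈r y∉R₁ y∉R₂

module _ {A : Set} {xs ys : List A} {z : A} where

  ∈-remove : ∀ {t} → t ∈ xs ++ z ∷ ys → t ≢ z → t ∈ xs ++ ys
  ∈-remove t∈ t≢z with ∈-resp-↭ (shift z xs ys) t∈
  ... | here t≡z = contradiction t≡z t≢z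
  ... | there t∈′ = t∈′

  ∈-insert : ∀ {t} → t ∈ xs ++ ys → t ∈ xs ++ z ∷ ys
  ∈-insert t∈ = ∈-resp-↭ (↭-sym (shift z xs ys)) (there t∈)

  unique-remove : Unique (xs ++ z ∷ ys) → z ∉ xs ++ ys × Unique (xs ++ ys)
  unique-remove u with Unique-resp-↭ (setoid A) (↭⇒↭ₛ (shift z xs ys)) u
  ... | z≢ ∷ u′ = (λ z∈ → lookup z≢ z∈ refl) , u′

module UniqueMatching {A : Set} (corners : A → List Pt) (apex : A → Pt) (width : A → ℕ) where

  record Ownership (I : List Pt) (L : List A) : Set where
    field
      owner : ∀ {y} → y ∈ I → ∃ λ t → t ∈ L × apex t ≡ y × y ∈ corners t
      owner-wider : ∀ {t y} → t ∈ L → y ∈ I → y ∈ corners t → apex t ≢ y →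
                    apex t ∈ I × ∃ λ t′ → t′ ∈ L × apex t′ ≡ y × width t < width t′
      apex-injective : ∀ {t t′} → t ∈ L → t′ ∈ L → apex t ≡ apex t′ → apex t ∈ I → t ≡ t′

  open Ownership

  narrowestOwner : ∀ I L {t₁} → t₁ ∈ L → apex t₁ ∈ I →
    ∃ λ t₀ → (t₀ ∈ L × apex t₀ ∈ I) × (∀ {t} → t ∈ L → apex t ∈ I → width t₀ ≤ width t)
  narrowestOwner I L {t₁} t₁∈L a₁∈I =
    argmin width t₁ owners ,
    argmin-all width (t₁∈L , a₁∈I) (tabulate (∈-filter⁻ owns?)) ,
    λ t∈L a∈I → lookup (f[argmin]≤f[xs] t₁ owners) (∈-filter⁺ owns? t∈L a∈I)
    where
    owns? : ∀ t → Dec (apex t ∈ I)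
    owns? t = Any.any? (apex t ≟Pt_) I
    owners = filter owns? L

  -- The narrowest owner t₀ is the only region containing its apex.
  module _ {I L t₀} (own : Ownership I L) (t₀∈L : t₀ ∈ L) (a₀∈I : apex t₀ ∈ I)
           (narrowest : ∀ {t} → t ∈ L → apex t ∈ I → width t₀ ≤ width t) where

    apex∈corners : apex t₀ ∈ corners t₀
    apex∈corners with t , t∈L , a≡a₀ , a₀∈t ← owner own a₀∈I
      rewrite apex-injective own t∈L t₀∈L a≡a₀ (subst (_∈ I) (sym a≡a₀) a₀∈I) = a₀∈t

    apex∉corners : ∀ {t} → t ∈ L → t ≢ t₀ → apex t₀ ∉ corners t
    apex∉corners {t} t∈L t≢t₀ a₀∈t with apex t ≟Pt apex t₀
    ... | yes a≡a₀ = t≢t₀ (apex-injective own t∈L t₀∈L a≡a₀ (subst (_∈ I) (sym a≡a₀) a₀∈I))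
    ... | no a≢a₀ with owner-wider own t∈L a₀∈I a₀∈t a≢a₀
    ... | a∈I , t′ , t′∈L , a′≡a₀ , t<t′
      rewrite apex-injective own t′∈L t₀∈L a′≡a₀ (subst (_∈ I) (sym a′≡a₀) a₀∈I) = <⇒≱ t<t′ (narrowest t∈L a∈I)

  ownership-remove : ∀ I₁ I₂ L₁ L₂ {t₀} → Unique (I₁ ++ apex t₀ ∷ I₂) → Unique (L₁ ++ t₀ ∷ L₂) →
    Ownership (I₁ ++ apex t₀ ∷ I₂) (L₁ ++ t₀ ∷ L₂) → Ownership (I₁ ++ I₂) (L₁ ++ L₂)
  ownership-remove I₁ I₂ L₁ L₂ {t₀} uI uL own = record
    { owner = λ y∈ → let t , t∈L , a≡y , y∈t = owner own (∈-insert y∈) in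
        t , ∈-remove t∈L (kept a≡y y∈) , a≡y , y∈t
    ; owner-wider = λ t∈ y∈ y∈t a≢y →
        let a∈I , t′ , t′∈L , a′≡y , t<t′ = owner-wider own (∈-insert t∈) (∈-insert y∈) y∈t a≢y in
        ∈-remove a∈I (λ a≡a₀ → t₀∉L′ (subst (_∈ L₁ ++ L₂) (apex-injective own (∈-insert t∈) t₀∈L a≡a₀ a∈I) t∈)) ,
        t′ , ∈-remove t′∈L (kept a′≡y y∈) , a′≡y , t<t′
    ; apex-injective = λ t∈ t′∈ a≡a′ a∈ → apex-injective own (∈-insert t∈) (∈-insert t′∈) a≡a′ (∈-insert a∈)
    }
    where
    a₀∉I′ = proj₁ (unique-remove uI)
    t₀∉L′ = proj₁ (unique-remove uL)
    kept : ∀ {t y} → apex t ≡ y → y ∈ I₁ ++ I₂ → t ≢ t₀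
    kept a≡y y∈ refl = a₀∉I′ (subst (_∈ I₁ ++ I₂) (sym a≡y) y∈)
    t₀∈L : t₀ ∈ L₁ ++ t₀ ∷ L₂
    t₀∈L = ∈-resp-↭ (↭-sym (shift t₀ L₁ L₂)) (here refl)

  count≡1 : ∀ n I L → length I ≡ n → Unique I → Unique L → Ownership I L → matchCount I (map corners L) ≡ 1
  peel-narrowest : ∀ n I L → length I ≡ suc n → Unique I → Unique L → Ownership I L → ∀ {y₀} → y₀ ∈ I →
    matchCount I (map corners L) ≡ 1

  count≡1 zero [] L _ _ _ _ = refl
  count≡1 (suc n) (y ∷ I) L |I| uI uL own = peel-narrowest n (y ∷ I) L |I| uI uL own (here refl)

  peel-narrowest n I L |I| uI uL own y₀∈I
    with t₁ , t₁∈L , refl , _ ← owner own y₀∈I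
    with t₀ , (t₀∈L , a₀∈I) , narrowest ← narrowestOwner I L t₁∈L y₀∈I
    with I₁ , I₂ , refl ← ∈-∃++ a₀∈I | L₁ , L₂ , refl ← ∈-∃++ t₀∈L = begin
      matchCount (I₁ ++ apex t₀ ∷ I₂) (map corners (L₁ ++ t₀ ∷ L₂))
        ≡⟨ matchCount-↭ (shift (apex t₀) I₁ I₂) _ ⟩
      choices (apex t₀) (matchCount (I₁ ++ I₂)) (map corners (L₁ ++ t₀ ∷ L₂))
        ≡⟨ cong (choices (apex t₀) (matchCount (I₁ ++ I₂))) (map-++ corners L₁ (t₀ ∷ L₂)) ⟩
      choices (apex t₀) (matchCount (I₁ ++ I₂)) (map corners L₁ ++ corners t₀ ∷ map corners L₂)
        ≡⟨ choices-single (apex t₀) _ (map corners L₁) (corners t₀) (map corners L₂)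
             (apex∈corners own t₀∈L a₀∈I narrowest) (others L₁ ∈-++⁺ˡ) (others L₂ (∈-++⁺ʳ L₁)) ⟩
      matchCount (I₁ ++ I₂) (map corners L₁ ++ map corners L₂)
        ≡⟨ cong (matchCount (I₁ ++ I₂)) (map-++ corners L₁ L₂) ⟨
      matchCount (I₁ ++ I₂) (map corners (L₁ ++ L₂))
        ≡⟨ count≡1 n _ _ |I′| (proj₂ (unique-remove uI)) (proj₂ (unique-remove uL))
             (ownership-remove I₁ I₂ L₁ L₂ uI uL own) ⟩
      1 ∎
    where
    open ≡-Reasoning
    |I′| : length (I₁ ++ I₂) ≡ n
    |I′| = suc-injective (trans (sym (↭-length (shift (apex t₀) I₁ I₂))) |I|)
    others : ∀ L′ → (∀ {t} → t ∈ L′ → t ∈ L₁ ++ L₂) → All (apex t₀ ∉_) (map corners L′)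
    others [] _ = []
    others (t ∷ L′) ⊆L = apex∉corners own t₀∈L a₀∈I narrowest (∈-insert (⊆L (here refl)))
                           (λ { refl → proj₁ (unique-remove uL) (⊆L (here refl)) })
                         ∷ others L′ (⊆L ∘ there)

  ownership⇒matchCount≡1 : ∀ {I L} → Unique I → Unique L → Ownership I L → matchCount I (map corners L) ≡ 1
  ownership⇒matchCount≡1 {I} {L} = count≡1 (length I) I L refl

module Labels (N : ℕ) {{_ : NonZero N}} where

  open ≡-Reasoning

  1≤N : 1 ≤ N
  1≤N = >-nonZero⁻¹ N

  toℕ-lab : ∀ x → toℕ (lab N x) ≡ x % N
  toℕ-lab x = toℕ-fromℕ< _

  lab-cong : ∀ {x y} → x % N ≡ y % N → lab N x ≡ lab N y
  lab-cong {x} {y} eq = toℕ-injective (trans (toℕ-lab x) (trans eq (sym (toℕ-lab y))))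

  lab-+* : ∀ x d → lab N (x + d * N) ≡ lab N x
  lab-+* x d = lab-cong ([m+kn]%n≡m%n x d N)

  lab-+N : ∀ x → lab N (x + N) ≡ lab N x
  lab-+N x = lab-cong ([m+n]%n≡m%n x N)

  lab-toℕ+* : (k : Fin N) (t : ℕ) → lab N (toℕ k + t * N) ≡ k
  lab-toℕ+* k t = toℕ-injective (trans (toℕ-lab _) (trans ([m+kn]%n≡m%n (toℕ k) t N) (m<n⇒m%n≡m (toℕ<n k))))

  lab-toℕ : (k : Fin N) → lab N (toℕ k) ≡ k
  lab-toℕ k = toℕ-injective (trans (toℕ-lab _) (m<n⇒m%n≡m (toℕ<n k)))

  lab+sheet : ∀ x → toℕ (lab N x) + (x / N) * N ≡ x
  lab+sheet x = sym (trans (m≡m%n+[m/n]*n x N) (cong (_+ (x / N) * N) (sym (toℕ-lab x))))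

  residueLen : ℕ → ℕ
  residueLen zero = N
  residueLen (suc d) = suc d

  len≡residueLen : ∀ i j → len N i j ≡ residueLen ((toℕ j + N ∸ toℕ i) % N)
  len≡residueLen i j with (toℕ j + N ∸ toℕ i) % N
  ... | zero = refl
  ... | suc d = refl

  residueLen-% : ∀ m → residueLen (m % N) % N ≡ m % N
  residueLen-% m with m % N in eq
  ... | zero = n%n≡0 N
  ... | suc d = trans (cong (_% N) (sym eq)) (trans (m%n%n≡m%n m N) eq)

  1≤len : ∀ i j → 1 ≤ len N i j
  1≤len i j rewrite len≡residueLen i j with (toℕ j + N ∸ toℕ i) % N
  ... | zero = 1≤N
  ... | suc d = s≤s z≤n

  len≤N : ∀ i j → len N i j ≤ N
  len≤N i j rewrite len≡residueLen i j with (toℕ j + N ∸ toℕ i) % N | m%n<n (toℕ j + N ∸ toℕ i) N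
  ... | zero | _ = ≤-refl
  ... | suc d | d<N = <⇒≤ d<N

  toℕ+len-% : (k l : Fin N) → (toℕ k + len N k l) % N ≡ toℕ l
  toℕ+len-% k l = begin
      (toℕ k + len N k l) % N                 ≡⟨ cong (λ z → (toℕ k + z) % N) (len≡residueLen k l) ⟩
      (toℕ k + residueLen (s % N)) % N        ≡⟨ %-distribˡ-+ (toℕ k) _ N ⟩
      (toℕ k % N + residueLen (s % N) % N) % N ≡⟨ cong (λ z → (toℕ k % N + z) % N) (residueLen-% s) ⟩
      (toℕ k % N + s % N) % N                 ≡⟨ %-distribˡ-+ (toℕ k) s N ⟨
      (toℕ k + s) % N                         ≡⟨ cong (_% N) (m+[n∸m]≡n (≤-trans (<⇒≤ (toℕ<n k)) (m≤n+m N (toℕ l)))) ⟩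
      (toℕ l + N) % N                         ≡⟨ [m+n]%n≡m%n (toℕ l) N ⟩
      toℕ l % N                               ≡⟨ m<n⇒m%n≡m (toℕ<n l) ⟩
      toℕ l                                   ∎
    where s = toℕ l + N ∸ toℕ k

  lab-toℕ+len : (k l : Fin N) → lab N (toℕ k + len N k l) ≡ l
  lab-toℕ+len k l = toℕ-injective (trans (toℕ-lab _) (toℕ+len-% k l))

  lab-toℕ+len+* : (k l : Fin N) (t : ℕ) → lab N (toℕ k + len N k l + t * N) ≡ l
  lab-toℕ+len+* k l t = trans (lab-+* (toℕ k + len N k l) t) (lab-toℕ+len k l)

  len-lab-+ : ∀ x e → 1 ≤ e → e ≤ N → len N (lab N x) (lab N (x + e)) ≡ e
  len-lab-+ x e 1≤e e≤N = trans (len≡residueLen (lab N x) (lab N (x + e))) (trans (cong residueLen gap) residueLen-e)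
    where
    r = x % N
    r<N : r < N
    r<N = m%n<n x N
    x+e≡ : (x + e) % N ≡ (r + e) % N
    x+e≡ = trans (cong (λ z → (z + e) % N) (m≡m%n+[m/n]*n x N))
           (trans (cong (_% N) (trans (+-assoc r _ e) (trans (cong (r +_) (+-comm _ e)) (sym (+-assoc r e _)))))
                  ([m+kn]%n≡m%n (r + e) (x / N) N))
    gap : (toℕ (lab N (x + e)) + N ∸ toℕ (lab N x)) % N ≡ e % N
    gap rewrite toℕ-lab (x + e) | toℕ-lab x | x+e≡ with r + e <? N
    ... | yes r+e<N rewrite m<n⇒m%n≡m r+e<N = begin
          (r + e + N ∸ r) % N ≡⟨ cong (_% N) (trans (cong (_∸ r) (+-assoc r e N)) (m+n∸m≡n r (e + N))) ⟩
          (e + N) % N         ≡⟨ [m+n]%n≡m%n e N ⟩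
          e % N               ∎
    ... | no r+e≮N = begin
          ((r + e) % N + N ∸ r) % N ≡⟨ cong (λ z → (z % N + N ∸ r) % N) r+e≡g+N ⟩
          ((g + N) % N + N ∸ r) % N ≡⟨ cong (λ z → (z + N ∸ r) % N) (trans ([m+n]%n≡m%n g N) (m<n⇒m%n≡m g<N)) ⟩
          (g + N ∸ r) % N           ≡⟨ cong (_% N) (trans (cong (_∸ r) (sym r+e≡g+N)) (m+n∸m≡n r e)) ⟩
          e % N                     ∎
      where
      g = r + e ∸ N
      r+e≡g+N : r + e ≡ g + N
      r+e≡g+N = sym (m∸n+n≡m (≮⇒≥ r+e≮N))
      g<N : g < N
      g<N = +-cancelʳ-< _ _ N (subst (_< N + N) r+e≡g+N (+-mono-<-≤ r<N e≤N))
    residueLen-e : residueLen (e % N) ≡ e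
    residueLen-e with m≤n⇒m<n∨m≡n e≤N
    ... | inj₂ refl = cong residueLen (n%n≡0 N)
    ... | inj₁ e<N rewrite m<n⇒m%n≡m e<N = residueLen-pos 1≤e
      where
      residueLen-pos : ∀ {d} → 1 ≤ d → residueLen d ≡ d
      residueLen-pos {suc _} _ = refl

  len-next : ∀ k → len N k (next N k) ≡ 1
  len-next k = trans (cong₂ (len N) (sym (lab-toℕ k)) (cong (lab N) (+-comm 1 (toℕ k)))) (len-lab-+ (toℕ k) 1 ≤-refl 1≤N)

  2≤len : ∀ k l → l ≢ next N k → 2 ≤ len N k l
  2≤len k l l≢next with m≤n⇒m<n∨m≡n (1≤len k l)
  ... | inj₁ 1<len = 1<len
  ... | inj₂ 1≡len = contradiction
        (trans (sym (lab-toℕ+len k l)) (trans (cong (λ z → lab N (toℕ k + z)) (sym 1≡len)) (cong (lab N) (+-comm (toℕ k) 1))))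
        l≢next

  lab-+-valid : ∀ x e → 2 ≤ e → e ≤ N → lab N (x + e) ≢ next N (lab N x)
  lab-+-valid x e 2≤e e≤N eq =
    <⇒≢ 2≤e (sym (trans (sym (len-lab-+ x e (≤-trans (n≤1+n 1) 2≤e) e≤N)) (trans (cong (len N (lab N x)) eq) (len-next (lab N x)))))

  len-self : ∀ i → len N i i ≡ N
  len-self i = trans (len≡residueLen i i) (cong residueLen (trans (cong (_% N) (m+n∸m≡n (toℕ i) N)) (n%n≡0 N)))

  %-injective-window : ∀ {u v} → u < v → v < u + N → u % N ≢ v % N
  %-injective-window {u} {v} u<v v<u+N eq =
    <⇒≢ d<N (trans (sym len≡d) (trans (cong (len N (lab N u)) (sym (lab-cong eq))) (len-self (lab N u))))
    where
    d = v ∸ u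
    u+d≡v : u + d ≡ v
    u+d≡v = m+[n∸m]≡n (<⇒≤ u<v)
    d<N : d < N
    d<N = +-cancelˡ-< u d N (subst (_< u + N) (sym u+d≡v) v<u+N)
    len≡d : len N (lab N u) (lab N v) ≡ d
    len≡d = trans (cong (λ w → len N (lab N u) (lab N w)) (sym u+d≡v)) (len-lab-+ u d (m<n⇒0<n∸m u<v) (<⇒≤ d<N))

∈-range⁺ : ∀ {a b v} → a ≤ v → v < b → v ∈ range a b
∈-range⁺ {a} {b} a≤v v<b = subst (_∈ range a b) (m+[n∸m]≡n a≤v) (∈-map⁺ (a +_) (∈-upTo⁺ (∸-monoˡ-< v<b a≤v)))

∈-range⁻ : ∀ {a b v} → v ∈ range a b → a ≤ v × v < b
∈-range⁻ {a} {b} v∈ with w , w∈ , refl ← ∈-map⁻ (a +_) v∈ = m≤m+n a w , +-below a b w (∈-upTo⁻ w∈)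
  where
  +-below : ∀ a b w → w < b ∸ a → a + w < b
  +-below a b w w< = subst (a + w <_) (m+[n∸m]≡n (<⇒≤ a<b)) (+-monoʳ-< a w<)
    where
    a<b : a < b
    a<b = m∸n≢0⇒n<m (λ eq → n≮0 (subst (w <_) eq w<))

unique-range : ∀ a b → Unique (range a b)
unique-range a b = Unique.map⁺ (+-cancelˡ-≡ a _ _) (Unique.upTo⁺ (b ∸ a))

unique-concatMap : ∀ {A B : Set} (f : A → List B) (key : B → A) {xs : List A} → Unique xs →
  (∀ x → Unique (f x)) → (∀ {x b} → b ∈ f x → key b ≡ x) → Unique (concatMap f xs)
unique-concatMap f key {[]} [] _ _ = []
unique-concatMap f key {x ∷ xs} (x∉ ∷ uxs) uf keyed = Unique.++⁺ (uf x) (unique-concatMap f key uxs uf keyed) disjoint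
  where
  disjoint : ∀ {b} → ¬ (b ∈ f x × b ∈ concatMap f xs)
  disjoint (b∈fx , b∈rest) with x′ , x′∈xs , b∈fx′ ← find (∈-concatMap⁻ f {xs = xs} b∈rest) =
    lookup x∉ x′∈xs (trans (sym (keyed b∈fx)) (keyed b∈fx′))

module Enumeration (N : ℕ) {{_ : NonZero N}} (T : Arc N → Bool) where

  -- the lifted triangles listed by liftTris B, before filtering by isTri
  InWindow : ℕ → LTri → Set
  InWindow B (fin x y z) = x < B × x < y × y ≤ x + N × y < z × z ≤ x + N
  InWindow B (inf x y) = x < B × x < y × y ≤ x + N

  private
    withSecond : ℕ → ℕ → List LTri
    withSecond x y = inf x y ∷ map (fin x y) (range (suc y) (suc (x + N)))

    withFirst : ℕ → List LTri
    withFirst x = concatMap (withSecond x) (range (suc x) (suc (x + N)))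

    window : ℕ → List LTri
    window B = concatMap withFirst (upTo B)

    ∈-window⁺ : ∀ B t → InWindow B t → t ∈ window B
    ∈-window⁺ B (fin x y z) (x<B , x<y , y≤ , y<z , z≤) =
      ∈-concatMap⁺ _ (lose (∈-upTo⁺ x<B) (∈-concatMap⁺ _ (lose (∈-range⁺ x<y (s≤s y≤))
        (there (∈-map⁺ (fin x y) (∈-range⁺ y<z (s≤s z≤)))))))
    ∈-window⁺ B (inf x y) (x<B , x<y , y≤) =
      ∈-concatMap⁺ _ (lose (∈-upTo⁺ x<B) (∈-concatMap⁺ _ (lose (∈-range⁺ x<y (s≤s y≤)) (here refl))))

    ∈-window⁻ : ∀ B t → t ∈ window B → InWindow B t
    ∈-window⁻ B t t∈
      with x , x∈ , t∈x ← find (∈-concatMap⁻ withFirst {xs = upTo B} t∈)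
      with y , y∈ , t∈xy ← find (∈-concatMap⁻ (withSecond x) {xs = range (suc x) (suc (x + N))} t∈x)
      with x<y , y≤ ← ∈-range⁻ {suc x} {suc (x + N)} y∈
      with t∈xy
    ... | here refl = ∈-upTo⁻ x∈ , x<y , ≤-pred y≤
    ... | there t∈z with z , z∈ , refl ← ∈-map⁻ (fin x y) t∈z
      with y<z , z≤ ← ∈-range⁻ {suc y} {suc (x + N)} z∈ = ∈-upTo⁻ x∈ , x<y , ≤-pred y≤ , y<z , ≤-pred z≤

    first : LTri → ℕ
    first (fin x _ _) = x
    first (inf x _) = x

    second : LTri → ℕ
    second (fin _ y _) = y
    second (inf _ y) = y

    unique-withSecond : ∀ x y → Unique (withSecond x y)
    unique-withSecond x y = tabulate inf≢fin ∷ Unique.map⁺ (λ { refl → refl }) (unique-range (suc y) (suc (x + N)))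
      where
      inf≢fin : ∀ {t} → t ∈ map (fin x y) (range (suc y) (suc (x + N))) → inf x y ≢ t
      inf≢fin t∈ with _ , _ , refl ← ∈-map⁻ (fin x y) t∈ = λ ()

    second-withSecond : ∀ {y x t} → t ∈ withSecond x y → second t ≡ y
    second-withSecond (here refl) = refl
    second-withSecond {y} {x} (there t∈) with _ , _ , refl ← ∈-map⁻ (fin x y) t∈ = refl

    first-withFirst : ∀ {x t} → t ∈ withFirst x → first t ≡ x
    first-withFirst {x} t∈ with y , _ , t∈y ← find (∈-concatMap⁻ (withSecond x) {xs = range (suc x) (suc (x + N))} t∈)
      with t∈y
    ... | here refl = refl
    ... | there t∈z with _ , _ , refl ← ∈-map⁻ (fin x y) t∈z = refl

  ∈-liftTris⁺ : ∀ B t → InWindow B t → isTri N T t ≡ true → t ∈ liftTris N T B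
  ∈-liftTris⁺ B t inWindow isTri-t = ∈-filter⁺ (λ t → T? (isTri N T t)) (∈-window⁺ B t inWindow) (subst 𝔹.T (sym isTri-t) _)

  ∈-liftTris⁻ : ∀ B t → t ∈ liftTris N T B → InWindow B t × isTri N T t ≡ true
  ∈-liftTris⁻ B t t∈ with t∈w , isTri-t ← ∈-filter⁻ (λ t → T? (isTri N T t)) {xs = window B} t∈ =
    ∈-window⁻ B t t∈w , T⇒≡true isTri-t
    where
    T⇒≡true : ∀ {b} → 𝔹.T b → b ≡ true
    T⇒≡true {true} _ = refl

  unique-liftTris : ∀ B → Unique (liftTris N T B)
  unique-liftTris B = Unique.filter⁺ (λ t → T? (isTri N T t))
    (unique-concatMap withFirst first (Unique.upTo⁺ B)
      (λ x → unique-concatMap (withSecond x) second (unique-range (suc x) (suc (x + N))) (unique-withSecond x) second-withSecond)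
      first-withFirst)

T⇒≡true : ∀ {b} → 𝔹.T b → b ≡ true
T⇒≡true {true} _ = refl

≡true⇒T : ∀ {b} → b ≡ true → 𝔹.T b
≡true⇒T refl = tt

∧-≡true⁻ : ∀ {a b} → a ∧ b ≡ true → a ≡ true × b ≡ true
∧-≡true⁻ {true} eq = refl , eq

∧-≡true⁺ : ∀ {a b} → a ≡ true → b ≡ true → a ∧ b ≡ true
∧-≡true⁺ refl refl = refl

∨-≡true⁻ : ∀ {a b} → a ∨ b ≡ true → a ≡ true ⊎ b ≡ true
∨-≡true⁻ {true} _ = inj₁ refl
∨-≡true⁻ {false} eq = inj₂ eq

∨-≡true⁺ˡ : ∀ {a b} → a ≡ true → a ∨ b ≡ true
∨-≡true⁺ˡ refl = refl

∨-≡true⁺ʳ : ∀ {a b} → b ≡ true → a ∨ b ≡ true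
∨-≡true⁺ʳ {true} _ = refl
∨-≡true⁺ʳ {false} eq = eq

≡ᵇ-true⇒≡ : ∀ {m n} → (m ≡ᵇ n) ≡ true → m ≡ n
≡ᵇ-true⇒≡ {m} {n} eq = ≡ᵇ⇒≡ m n (≡true⇒T eq)

≡⇒≡ᵇ-true : ∀ {m n} → m ≡ n → (m ≡ᵇ n) ≡ true
≡⇒≡ᵇ-true {m} {n} eq = T⇒≡true (≡⇒≡ᵇ m n eq)

<ᵇ-true⇒< : ∀ {m n} → (m <ᵇ n) ≡ true → m < n
<ᵇ-true⇒< {m} {n} eq = <ᵇ⇒< m n (≡true⇒T eq)

<⇒<ᵇ-true : ∀ {m n} → m < n → (m <ᵇ n) ≡ true
<⇒<ᵇ-true m<n = T⇒≡true (<⇒<ᵇ m<n)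

≤ᵇ-true⇒≤ : ∀ {m n} → (m ≤ᵇ n) ≡ true → m ≤ n
≤ᵇ-true⇒≤ {m} {n} eq = ≤ᵇ⇒≤ m n (≡true⇒T eq)

≤⇒≤ᵇ-true : ∀ {m n} → m ≤ n → (m ≤ᵇ n) ≡ true
≤⇒≤ᵇ-true m≤n = T⇒≡true (≤⇒≤ᵇ m≤n)

+-∸-shift : ∀ x y c → (y + c) ∸ (x + c) ≡ y ∸ x
+-∸-shift x y c = trans (cong₂ _∸_ (+-comm y c) (+-comm x c)) ([m+n]∸[m+o]≡n∸o c y x)

greatest : {P : ℕ → Set} → (∀ v → Dec (P v)) → ∀ lo k → P lo →
  ∃ λ c → lo ≤ c × c ≤ lo + k × P c × (∀ {v} → c < v → v ≤ lo + k → ¬ P v)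
greatest P? lo zero Plo = lo , ≤-refl , m≤m+n lo 0 , Plo , λ {v} c<v v≤ _ → <⇒≱ c<v (subst (v ≤_) (+-identityʳ lo) v≤)
greatest P? lo (suc k) Plo with greatest P? lo k Plo | P? (lo + suc k)
... | _ | yes Ptop = lo + suc k , m≤m+n lo _ , ≤-refl , Ptop , λ c<v v≤ _ → <⇒≱ c<v v≤
... | c , lo≤c , c≤ , Pc , above | no ¬Ptop = c , lo≤c , ≤-trans c≤ (+-monoʳ-≤ lo (n≤1+n k)) , Pc , above′
  where
  above′ : ∀ {v} → c < v → v ≤ lo + suc k → ¬ _
  above′ {v} c<v v≤ with m≤n⇒m<n∨m≡n v≤
  ... | inj₁ v< = above c<v (≤-pred (subst (v <_) (+-suc lo k) v<))
  ... | inj₂ refl = ¬Ptop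

module Cover (N : ℕ) {{_ : NonZero N}} (T : Arc N → Bool) (tri : IsTriangulation N T) where

  open Labels N
  open Enumeration N T
  open IsTriangulation tri

  LiftedArc : ℕ → ℕ → Set
  LiftedArc x y = x < y × 2 ≤ y ∸ x × y ∸ x ≤ N × T (dArc (lab N x) (lab N y)) ≡ true

  IsEdge : ℕ → ℕ → Set
  IsEdge x y = suc x ≡ y ⊎ LiftedArc x y

  IsRay : ℕ → Set
  IsRay w = T (cArc (lab N w)) ≡ true

  IsTriangle : ℕ → ℕ → ℕ → Set
  IsTriangle x y z = IsEdge x y × IsEdge y z × IsEdge x z

  Edge⇒IsEdge : ∀ {x y} → Edge N T x y ≡ true → IsEdge x y
  Edge⇒IsEdge {x} {y} eq with ∨-≡true⁻ {suc x ≡ᵇ y} eq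
  ... | inj₁ adjacent = inj₁ (≡ᵇ-true⇒≡ adjacent)
  ... | inj₂ arc with ∧-≡true⁻ {x <ᵇ y} arc
  ... | x<y , arc′ with ∧-≡true⁻ {2 ≤ᵇ (y ∸ x)} arc′
  ... | 2≤ , arc″ with ∧-≡true⁻ {(y ∸ x) ≤ᵇ N} arc″
  ... | ≤N , Tarc = inj₂ (<ᵇ-true⇒< x<y , ≤ᵇ-true⇒≤ 2≤ , ≤ᵇ-true⇒≤ ≤N , Tarc)

  IsEdge⇒Edge : ∀ {x y} → IsEdge x y → Edge N T x y ≡ true
  IsEdge⇒Edge (inj₁ eq) = ∨-≡true⁺ˡ (≡⇒≡ᵇ-true eq)
  IsEdge⇒Edge {x} {y} (inj₂ (x<y , 2≤ , ≤N , Tarc)) =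
    ∨-≡true⁺ʳ {suc x ≡ᵇ y} (∧-≡true⁺ (<⇒<ᵇ-true x<y) (∧-≡true⁺ (≤⇒≤ᵇ-true 2≤) (∧-≡true⁺ (≤⇒≤ᵇ-true ≤N) Tarc)))

  isTri⇒IsTriangle : ∀ {x y z} → isTri N T (fin x y z) ≡ true → IsTriangle x y z
  isTri⇒IsTriangle {x} {y} {z} eq with ∧-≡true⁻ {x <ᵇ y} eq
  ... | _ , eq₁ with ∧-≡true⁻ {y <ᵇ z} eq₁
  ... | _ , eq₂ with ∧-≡true⁻ {Edge N T x y} eq₂
  ... | xy , eq₃ with ∧-≡true⁻ {Edge N T y z} eq₃
  ... | yz , xz = Edge⇒IsEdge xy , Edge⇒IsEdge yz , Edge⇒IsEdge xz

  isTri-inf⇒ : ∀ {x y} → isTri N T (inf x y) ≡ true → IsEdge x y × IsRay x × IsRay y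
  isTri-inf⇒ {x} {y} eq with ∧-≡true⁻ {x <ᵇ y} eq
  ... | _ , eq₁ with ∧-≡true⁻ {Edge N T x y} eq₁
  ... | xy , eq₂ with ∧-≡true⁻ {Ray N T x} eq₂
  ... | rx , ry = Edge⇒IsEdge xy , rx , ry

  edge< : ∀ {x y} → IsEdge x y → x < y
  edge< (inj₁ refl) = ≤-refl
  edge< (inj₂ arc) = proj₁ arc

  edge-length≤N : ∀ {x y} → IsEdge x y → y ∸ x ≤ N
  edge-length≤N {x} (inj₁ refl) = subst (_≤ N) (sym (trans (cong (_∸ x) (+-comm 1 x)) (m+n∸m≡n x 1))) 1≤N
  edge-length≤N (inj₂ arc) = proj₁ (proj₂ (proj₂ arc))

  edge≤+N : ∀ {x y} → IsEdge x y → y ≤ x + N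
  edge≤+N {x} {y} e = subst (_≤ x + N) (m+[n∸m]≡n (<⇒≤ (edge< e))) (+-monoʳ-≤ x (edge-length≤N e))

  IsTriangle⇒isTri : ∀ {x y z} → IsTriangle x y z → isTri N T (fin x y z) ≡ true
  IsTriangle⇒isTri (xy , yz , xz) =
    ∧-≡true⁺ (<⇒<ᵇ-true (edge< xy)) (∧-≡true⁺ (<⇒<ᵇ-true (edge< yz)) (∧-≡true⁺ (IsEdge⇒Edge xy) (∧-≡true⁺ (IsEdge⇒Edge yz) (IsEdge⇒Edge xz))))

  lab-end+sheet : ∀ x y → x < y → y ∸ x ≤ N → toℕ (lab N x) + len N (lab N x) (lab N y) + (x / N) * N ≡ y
  lab-end+sheet x y x<y y∸x≤N =
    trans (cong (λ z → toℕ (lab N x) + len N (lab N x) (lab N z) + (x / N) * N) (sym y≡x+d))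
    (trans (cong (λ z → toℕ (lab N x) + z + (x / N) * N) (len-lab-+ x (y ∸ x) (m<n⇒0<n∸m x<y) y∸x≤N))
    (trans (+-assoc (toℕ (lab N x)) _ _)
    (trans (cong (toℕ (lab N x) +_) (+-comm (y ∸ x) _))
    (trans (sym (+-assoc (toℕ (lab N x)) _ _))
    (trans (cong (_+ (y ∸ x)) (lab+sheet x)) y≡x+d)))))
    where
    y≡x+d : x + (y ∸ x) ≡ y
    y≡x+d = m+[n∸m]≡n (<⇒≤ x<y)

  edges-noncrossing : ∀ {x y u v} → IsEdge x y → IsEdge u v → ¬ Interleave N x y u v
  edges-noncrossing (inj₁ refl) _ (inj₁ (x<u , u<y , _)) = <⇒≱ x<u (≤-pred u<y)
  edges-noncrossing (inj₁ refl) _ (inj₂ (_ , x<v , v<y)) = <⇒≱ x<v (≤-pred v<y)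
  edges-noncrossing (inj₂ _) (inj₁ refl) (inj₁ (_ , u<y , y<v)) = <⇒≱ u<y (≤-pred y<v)
  edges-noncrossing (inj₂ _) (inj₁ refl) (inj₂ (u<x , x<v , _)) = <⇒≱ u<x (≤-pred x<v)
  edges-noncrossing {x} {y} {u} {v} (inj₂ (x<y , _ , ≤N , Txy)) (inj₂ (u<v , _ , ≤N′ , Tuv)) crossing =
    nonCrossing _ _ Txy Tuv (x / N , u / N ,
      subst₄ (Interleave N) (sym (lab+sheet x)) (sym (lab-end+sheet x y x<y ≤N))
                            (sym (lab+sheet u)) (sym (lab-end+sheet u v u<v ≤N′)) crossing)
    where
    subst₄ : ∀ (P : ℕ → ℕ → ℕ → ℕ → Set) {a b c d a′ b′ c′ d′} →
             a ≡ a′ → b ≡ b′ → c ≡ c′ → d ≡ d′ → P a b c d → P a′ b′ c′ d′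
    subst₄ P refl refl refl refl p = p

  edge-ray-noncrossing : ∀ {x y w} → IsEdge x y → IsRay w → ¬ (x < w × w < y)
  edge-ray-noncrossing (inj₁ refl) _ (x<w , w<y) = <⇒≱ x<w (≤-pred w<y)
  edge-ray-noncrossing {x} {y} {w} (inj₂ (x<y , _ , ≤N , Txy)) ray (x<w , w<y) =
    nonCrossing _ _ Txy ray (x / N , w / N ,
      subst₂ _<_ (sym (lab+sheet x)) (sym (lab+sheet w)) x<w ,
      subst₂ _<_ (sym (lab+sheet w)) (sym (lab-end+sheet x y x<y ≤N)) w<y)

  IsEdge-+* : ∀ {x y} c → IsEdge x y → IsEdge (x + c * N) (y + c * N)
  IsEdge-+* c (inj₁ eq) = inj₁ (cong (_+ c * N) eq)
  IsEdge-+* {x} {y} c (inj₂ (x<y , 2≤ , ≤N , Txy)) =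
    inj₂ (+-monoˡ-< (c * N) x<y , subst (2 ≤_) (sym (+-∸-shift x y (c * N))) 2≤ ,
          subst (_≤ N) (sym (+-∸-shift x y (c * N))) ≤N ,
          subst₂ (λ p q → T (dArc p q) ≡ true) (sym (lab-+* x c)) (sym (lab-+* y c)) Txy)

  IsEdge-∸* : ∀ {x y} c → IsEdge (x + c * N) (y + c * N) → IsEdge x y
  IsEdge-∸* {x} {y} c (inj₁ eq) = inj₁ (+-cancelʳ-≡ (c * N) (suc x) y eq)
  IsEdge-∸* {x} {y} c (inj₂ (x<y , 2≤ , ≤N , Txy)) =
    inj₂ (+-cancelʳ-< (c * N) x y x<y , subst (2 ≤_) (+-∸-shift x y (c * N)) 2≤ ,
          subst (_≤ N) (+-∸-shift x y (c * N)) ≤N ,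
          subst₂ (λ p q → T (dArc p q) ≡ true) (lab-+* x c) (lab-+* y c) Txy)

  IsRay-+* : ∀ {w} c → IsRay w → IsRay (w + c * N)
  IsRay-+* {w} c = subst (λ p → T (cArc p) ≡ true) (sym (lab-+* w c))

  IsRay-∸* : ∀ {w} c → IsRay (w + c * N) → IsRay w
  IsRay-∸* {w} c = subst (λ p → T (cArc p) ≡ true) (lab-+* w c)

  arc⇒IsEdge : ∀ {k l} → T (dArc k l) ≡ true → ∀ t → IsEdge (toℕ k + t * N) (toℕ k + len N k l + t * N)
  arc⇒IsEdge {k} {l} Tkl t =
    inj₂ (x<y , subst (2 ≤_) (sym y∸x) (2≤len k l (valid _ Tkl)) , subst (_≤ N) (sym y∸x) (len≤N k l) ,
          subst₂ (λ p q → T (dArc p q) ≡ true) (sym (lab-toℕ+* k t)) (sym (lab-toℕ+len+* k l t)) Tkl)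
    where
    y≡ : toℕ k + len N k l + t * N ≡ toℕ k + t * N + len N k l
    y≡ = trans (+-assoc (toℕ k) _ _) (trans (cong (toℕ k +_) (+-comm (len N k l) _)) (sym (+-assoc (toℕ k) _ _)))
    y∸x : (toℕ k + len N k l + t * N) ∸ (toℕ k + t * N) ≡ len N k l
    y∸x = trans (cong (_∸ (toℕ k + t * N)) y≡) (m+n∸m≡n (toℕ k + t * N) (len N k l))
    x<y : toℕ k + t * N < toℕ k + len N k l + t * N
    x<y = subst (toℕ k + t * N <_) (sym y≡) (m<m+n _ (1≤len k l))

  Interleave-+ : ∀ {p q r u} c → Interleave N p q r u → Interleave N (p + c) (q + c) (r + c) (u + c)
  Interleave-+ c (inj₁ (a , b , d)) = inj₁ (+-monoˡ-< c a , +-monoˡ-< c b , +-monoˡ-< c d)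
  Interleave-+ c (inj₂ (a , b , d)) = inj₂ (+-monoˡ-< c a , +-monoˡ-< c b , +-monoˡ-< c d)

  Uncrossed : ℕ → ℕ → Set
  Uncrossed x y = ∀ d → (∀ {u v} → IsEdge u v → ¬ Interleave N (x + d * N) (y + d * N) u v)
                      × (∀ {w} → IsRay w → ¬ (x + d * N < w × w < y + d * N))

  -- Lifting both sides of a crossing by q ∸ s sheets brings the lift on sheet s
  -- of the arc through x to the sheet of x or above.
  uncrossed⇒arc : ∀ {x y} → x < y → 2 ≤ y ∸ x → y ∸ x ≤ N → Uncrossed x y → T (dArc (lab N x) (lab N y)) ≡ true
  uncrossed⇒arc {x} {y} x<y 2≤ ≤N uncrossed =
    maximal (dArc (lab N x) (lab N y)) (λ eq → lab-+-valid x (y ∸ x) 2≤ ≤N (trans (cong (lab N) (m+[n∸m]≡n (<⇒≤ x<y))) eq)) noCross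
    where
    q = x / N
    X = toℕ (lab N x)
    Y = X + len N (lab N x) (lab N y)
    sheet-+ : ∀ a s e → a + (s + e) * N ≡ a + s * N + e * N
    sheet-+ a s e = trans (cong (a +_) (*-distribʳ-+ N s e)) (sym (+-assoc a _ _))
    balance : ∀ q s → s + (q ∸ s) ≡ q + (s ∸ q)
    balance zero zero = refl
    balance zero (suc s) = +-identityʳ (suc s)
    balance (suc q) zero = sym (+-identityʳ (suc q))
    balance (suc q) (suc s) = cong suc (balance q s)
    resheet : ∀ a s → a + s * N + (q ∸ s) * N ≡ a + q * N + (s ∸ q) * N
    resheet a s = trans (sym (sheet-+ a s (q ∸ s))) (trans (cong (λ z → a + z * N) (balance q s)) (sheet-+ a q (s ∸ q)))
    x-resheet : ∀ s → X + s * N + (q ∸ s) * N ≡ x + (s ∸ q) * N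
    x-resheet s = trans (resheet X s) (cong (_+ (s ∸ q) * N) (lab+sheet x))
    y-resheet : ∀ s → Y + s * N + (q ∸ s) * N ≡ y + (s ∸ q) * N
    y-resheet s = trans (resheet Y s) (cong (_+ (s ∸ q) * N) (lab-end+sheet x y x<y ≤N))
    noCross : ∀ b → T b ≡ true → ¬ Cross N (dArc (lab N x) (lab N y)) b
    noCross (dArc k l) Tkl (s , t , crossing) =
      proj₁ (uncrossed (s ∸ q)) (arc⇒IsEdge Tkl (t + (q ∸ s)))
        (subst₂ (λ a b → Interleave N a b (toℕ k + (t + e) * N) (toℕ k + len N k l + (t + e) * N)) (x-resheet s) (y-resheet s)
          (subst₂ (Interleave N _ _) (sym (sheet-+ (toℕ k) t e)) (sym (sheet-+ (toℕ k + len N k l) t e))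
            (Interleave-+ (e * N) crossing)))
      where e = q ∸ s
    noCross (cArc k) Tk (s , t , x<k , k<y) =
      proj₂ (uncrossed (s ∸ q)) (subst (λ p → T (cArc p) ≡ true) (sym (lab-toℕ+* k (t + (q ∸ s)))) Tk)
        (subst₂ _<_ (x-resheet s) (sym (sheet-+ (toℕ k) t _)) (+-monoˡ-< ((q ∸ s) * N) x<k) ,
         subst₂ _<_ (sym (sheet-+ (toℕ k) t _)) (y-resheet s) (+-monoˡ-< ((q ∸ s) * N) k<y))

  IsEdge? : ∀ x y → Dec (IsEdge x y)
  IsEdge? x y with Edge N T x y in eq
  ... | true = yes (Edge⇒IsEdge eq)
  ... | false = no (λ e → contradiction (trans (sym eq) (IsEdge⇒Edge e)) λ ())

  -- The apex c of the triangle below the edge ab is the last vertex joined to a.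
  triangleBelow : ∀ {a b} → IsEdge a b → 2 + a ≤ b → ∃ λ c → a < c × c < b × IsEdge a c × IsEdge c b
  triangleBelow {a} {b} ab 2+a≤b with greatest (IsEdge? a) (suc a) (b ∸ (2 + a)) (inj₁ refl)
  ... | c , a<c , c≤ , ac , last = c , a<c , c<b , ac , cb
    where
    b≡ : suc (suc a + (b ∸ (2 + a))) ≡ b
    b≡ = m+[n∸m]≡n 2+a≤b
    c<b : c < b
    c<b = subst (c <_) b≡ (s≤s c≤)
    cb : IsEdge c b
    cb with m≤n⇒m<n∨m≡n c≤
    ... | inj₂ refl = inj₁ b≡
    ... | inj₁ c<top = inj₂ (c<b , 2≤ , ≤N , uncrossed⇒arc c<b 2≤ ≤N uncrossed)
      where
      2≤ : 2 ≤ b ∸ c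
      2≤ = m+n≤o⇒m≤o∸n 2 (subst (suc c <_) b≡ (s≤s c<top))
      ≤N : b ∸ c ≤ N
      ≤N = ≤-trans (∸-monoʳ-≤ b (<⇒≤ a<c)) (edge-length≤N ab)
      uncrossed : Uncrossed c b
      uncrossed d = noEdge , noRay
        where
        ab′ = IsEdge-+* d ab
        a<c′ = +-monoˡ-< (d * N) a<c
        noEdge : ∀ {u v} → IsEdge u v → ¬ Interleave N (c + d * N) (b + d * N) u v
        noEdge uv (inj₁ (c<u , u<b , b<v)) = edges-noncrossing ab′ uv (inj₁ (<-trans a<c′ c<u , u<b , b<v))
        noEdge {u} {v} uv (inj₂ (u<c , c<v , v<b)) with <-cmp u (a + d * N)
        ... | tri< u<a _ _ = edges-noncrossing ab′ uv (inj₂ (u<a , <-trans a<c′ c<v , v<b))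
        ... | tri> _ _ a<u = edges-noncrossing (IsEdge-+* d ac) uv (inj₁ (a<u , u<c , c<v))
        ... | tri≈ _ refl _ = last c<w w≤ (IsEdge-∸* d (subst (IsEdge (a + d * N)) v≡ uv))
          where
          w = v ∸ d * N
          v≡ : v ≡ w + d * N
          v≡ = sym (m∸n+n≡m (≤-trans (m≤n+m (d * N) a) (<⇒≤ (edge< uv))))
          c<w : c < w
          c<w = +-cancelʳ-< (d * N) c w (subst (c + d * N <_) v≡ c<v)
          w≤ : w ≤ suc a + (b ∸ (2 + a))
          w≤ = ≤-pred (subst (w <_) (sym b≡) (+-cancelʳ-< (d * N) w b (subst (_< b + d * N) v≡ v<b)))
        noRay : ∀ {w} → IsRay w → ¬ (c + d * N < w × w < b + d * N)
        noRay ray (c<w , w<b) = edge-ray-noncrossing ab′ ray (<-trans a<c′ c<w , w<b)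

  MiddleTriangle : ℕ → ℕ → ℕ → Set
  MiddleTriangle a b y = ∃ λ x → ∃ λ z → a ≤ x × x < y × y < z × z ≤ b × IsTriangle x y z

  middleTriangle : ∀ {a b} → IsEdge a b → ∀ {y} → a < y → y < b → MiddleTriangle a b y
  middleTriangle {a} {b} = search (b ∸ a) ≤-refl
    where
    search : ∀ fuel {a b} → b ∸ a ≤ fuel → IsEdge a b → ∀ {y} → a < y → y < b → MiddleTriangle a b y
    search zero b∸a≤0 _ a<y y<b = contradiction b∸a≤0 (<⇒≱ (m<n⇒0<n∸m (<-trans a<y y<b)))
    search (suc fuel) {a} {b} b∸a≤ ab {y} a<y y<b with triangleBelow ab (≤-trans (s≤s a<y) y<b)
    ... | c , a<c , c<b , ac , cb with <-cmp y c
    ... | tri≈ _ refl _ = a , b , ≤-refl , a<y , y<b , ≤-refl , ac , cb , ab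
    ... | tri< y<c _ _ =
          let x , z , a≤x , x<y , y<z , z≤c , t = search fuel (≤-pred (<-≤-trans (∸-monoˡ-< c<b (<⇒≤ a<c)) b∸a≤)) ac a<y y<c
          in x , z , a≤x , x<y , y<z , ≤-trans z≤c (<⇒≤ c<b) , t
    ... | tri> _ _ c<y =
          let x , z , c≤x , x<y , y<z , z≤b , t = search fuel (≤-pred (<-≤-trans (∸-monoʳ-< a<c (<⇒≤ c<b)) b∸a≤)) cb c<y y<b
          in x , z , ≤-trans (<⇒≤ a<c) c≤x , x<y , y<z , z≤b , t

  middleTriangle-unique : ∀ {x y z x′ z′} → IsTriangle x y z → IsTriangle x′ y z′ → x ≡ x′ × z ≡ z′
  middleTriangle-unique {x} {y} {z} {x′} {z′} (xy , yz , xz) (x′y , yz′ , x′z′) = x≡x′ , z≡z′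
    where
    x≡x′ : x ≡ x′
    x≡x′ with <-cmp x x′
    ... | tri≈ _ eq _ = eq
    ... | tri< x<x′ _ _ = contradiction (inj₁ (x<x′ , edge< x′y , edge< yz′)) (edges-noncrossing xy x′z′)
    ... | tri> _ _ x′<x = contradiction (inj₁ (x′<x , edge< xy , edge< yz)) (edges-noncrossing x′y xz)
    z≡z′ : z ≡ z′
    z≡z′ with <-cmp z z′
    ... | tri≈ _ eq _ = eq
    ... | tri< z<z′ _ _ = contradiction (inj₁ (edge< xy , edge< yz , z<z′)) (edges-noncrossing xz yz′)
    ... | tri> _ _ z′<z = contradiction (inj₁ (edge< x′y , edge< yz′ , z′<z)) (edges-noncrossing x′z′ yz)

  width : ℕ → ℕ → ℕ
  width x z = z ∸ x

  leftCorner-narrower : ∀ {x y z y′ z′} → IsTriangle x y z → IsTriangle y y′ z′ → width y z′ < width x z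
  leftCorner-narrower {x} {y} {z} {y′} {z′} (xy , yz , xz) (yy′ , y′z′ , yz′) with <-cmp z z′
  ... | tri< z<z′ _ _ = contradiction (inj₁ (edge< xy , edge< yz , z<z′)) (edges-noncrossing xz yz′)
  ... | tri≈ _ refl _ = ∸-monoʳ-< (edge< xy) (<⇒≤ (edge< yz))
  ... | tri> _ _ z′<z = <-≤-trans (∸-monoˡ-< z′<z (<⇒≤ (<-trans (edge< yy′) (edge< y′z′)))) (∸-monoʳ-≤ z (<⇒≤ (edge< xy)))

  rightCorner-narrower : ∀ {x y z x′ y′} → IsTriangle x y z → IsTriangle x′ y′ y → width x′ y < width x z
  rightCorner-narrower {x} {y} {z} {x′} {y′} (xy , yz , xz) (x′y′ , y′y , x′y) with <-cmp x x′
  ... | tri> _ _ x′<x = contradiction (inj₁ (x′<x , edge< xy , edge< yz)) (edges-noncrossing x′y xz)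
  ... | tri≈ _ refl _ = ∸-monoˡ-< (edge< yz) (<⇒≤ (edge< xy))
  ... | tri< x<x′ _ _ = <-≤-trans (∸-monoʳ-< x<x′ (<⇒≤ (<-trans (edge< x′y′) (edge< y′y)))) (∸-monoˡ-≤ x (<⇒≤ (edge< yz)))

  inWindow-fin : ∀ {B x y z} → x < B → IsTriangle x y z → InWindow B (fin x y z)
  inWindow-fin x<B (xy , yz , xz) = x<B , edge< xy , ≤-trans (<⇒≤ (edge< yz)) (edge≤+N xz) , edge< yz , edge≤+N xz

  inI⇒ : ∀ {a b v} → inI N T a b v ≡ true → a ≤ v × v ≤ b
  inI⇒ {a} {b} {v} eq with a≤v , v≤b ← ∧-≡true⁻ {a ≤ᵇ v} eq = ≤ᵇ-true⇒≤ a≤v , ≤ᵇ-true⇒≤ v≤b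

  ⇒inI : ∀ {a b v} → a ≤ v → v ≤ b → inI N T a b v ≡ true
  ⇒inI a≤v v≤b = ∧-≡true⁺ (≤⇒≤ᵇ-true a≤v) (≤⇒≤ᵇ-true v≤b)

  crossChord⇒Interleave : ∀ {a b u v} → crossChord N T a b u v ≡ true → Interleave N a b u v
  crossChord⇒Interleave {a} {b} {u} {v} eq with ∨-≡true⁻ {(a <ᵇ u) ∧ (u <ᵇ b) ∧ (b <ᵇ v)} eq
  ... | inj₁ eq₁ with a<u , eq₂ ← ∧-≡true⁻ {a <ᵇ u} eq₁ with u<b , b<v ← ∧-≡true⁻ {u <ᵇ b} eq₂ =
    inj₁ (<ᵇ-true⇒< a<u , <ᵇ-true⇒< u<b , <ᵇ-true⇒< b<v)
  ... | inj₂ eq₁ with u<a , eq₂ ← ∧-≡true⁻ {u <ᵇ a} eq₁ with a<v , v<b ← ∧-≡true⁻ {a <ᵇ v} eq₂ =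
    inj₂ (<ᵇ-true⇒< u<a , <ᵇ-true⇒< a<v , <ᵇ-true⇒< v<b)

  ∈-finVerts-fin : ∀ {v x y z} → v ∈ finVerts N T (fin x y z) → v ≡ x ⊎ v ≡ y ⊎ v ≡ z
  ∈-finVerts-fin (here eq) = inj₁ eq
  ∈-finVerts-fin (there (here eq)) = inj₂ (inj₁ eq)
  ∈-finVerts-fin (there (there (here eq))) = inj₂ (inj₂ eq)

  pos∈piecePts⁻ : ∀ {a b v t} → pos v ∈ piecePts N T a b t → v ∈ finVerts N T t × a ≤ v × v ≤ b
  pos∈piecePts⁻ {a} {b} {v} {t} v∈
    with w , w∈ , refl ← ∈-map⁻ pos v∈
    with v∈t , inI-v ← ∈-filter⁻ (λ w → T? (inI N T a b w)) {xs = finVerts N T t} w∈ = v∈t , inI⇒ (T⇒≡true inI-v)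

  pos∈piecePts⁺ : ∀ {a b v t} → v ∈ finVerts N T t → a ≤ v → v ≤ b → pos v ∈ piecePts N T a b t
  pos∈piecePts⁺ {a} {b} v∈t a≤v v≤b = ∈-map⁺ pos (∈-filter⁺ (λ w → T? (inI N T a b w)) v∈t (≡true⇒T (⇒inI a≤v v≤b)))

  -- The lift of S_ij is the polygon under the edge ab; only the triangles inside
  -- it meet it, and every boundary point strictly between a and b owns the
  -- triangle of which it is the middle vertex.
  module Truncation {a b} (ab : IsEdge a b) (b<4N : b < 4 * N) where

    regions : List LTri
    regions = filterᵇ (meets N T a b) (liftTris N T (4 * N))

    points : List Pt
    points = map pos (range (suc a) b)

    apex : LTri → Pt
    apex (fin x y z) = pos y
    apex (inf x y) = punct

    triWidth : LTri → ℕ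
    triWidth (fin x y z) = width x z
    triWidth (inf x y) = 0

    Inside : LTri → Set
    Inside t = ∃ λ x → ∃ λ y → ∃ λ z → t ≡ fin x y z × a ≤ x × z ≤ b × IsTriangle x y z

    meets⇒Inside : ∀ t → meets N T a b t ≡ true → isTri N T t ≡ true → Inside t
    meets⇒Inside (fin x y z) meets-t isTri-t with ∨-≡true⁻ {inI N T a b x ∧ inI N T a b y ∧ inI N T a b z} meets-t
    ... | inj₁ eq₁ with inx , eq₂ ← ∧-≡true⁻ {inI N T a b x} eq₁ with _ , inz ← ∧-≡true⁻ {inI N T a b y} eq₂ =
      x , y , z , refl , proj₁ (inI⇒ inx) , proj₂ (inI⇒ {a} {b} inz) , isTri⇒IsTriangle isTri-t
    ... | inj₂ eq₁ with xy , yz , xz ← isTri⇒IsTriangle isTri-t with ∨-≡true⁻ {crossChord N T a b x y} eq₁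
    ... | inj₁ c = contradiction (crossChord⇒Interleave c) (edges-noncrossing ab xy)
    ... | inj₂ eq₂ with ∨-≡true⁻ {crossChord N T a b y z} eq₂
    ... | inj₁ c = contradiction (crossChord⇒Interleave c) (edges-noncrossing ab yz)
    ... | inj₂ c = contradiction (crossChord⇒Interleave c) (edges-noncrossing ab xz)
    meets⇒Inside (inf x y) meets-t isTri-t with xy , x-ray , y-ray ← isTri-inf⇒ isTri-t
                                           with ∨-≡true⁻ {crossChord N T a b x y} meets-t
    ... | inj₁ c = contradiction (crossChord⇒Interleave c) (edges-noncrossing ab xy)
    ... | inj₂ eq₁ with ∨-≡true⁻ {(a <ᵇ x) ∧ (x <ᵇ b)} eq₁
    ... | inj₁ eq₂ with a<x , x<b ← ∧-≡true⁻ {a <ᵇ x} eq₂ =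
      contradiction (<ᵇ-true⇒< a<x , <ᵇ-true⇒< x<b) (edge-ray-noncrossing ab x-ray)
    ... | inj₂ eq₂ with a<y , y<b ← ∧-≡true⁻ {a <ᵇ y} eq₂ =
      contradiction (<ᵇ-true⇒< a<y , <ᵇ-true⇒< y<b) (edge-ray-noncrossing ab y-ray)

    region-inside : ∀ {t} → t ∈ regions → Inside t
    region-inside {t} t∈ with t∈lift , meets-t ← ∈-filter⁻ (λ w → T? (meets N T a b w)) {xs = liftTris N T (4 * N)} t∈ =
      meets⇒Inside t (T⇒≡true meets-t) (proj₂ (∈-liftTris⁻ (4 * N) t t∈lift))

    inside-region : ∀ {x y z} → a ≤ x → z ≤ b → IsTriangle x y z → fin x y z ∈ regions
    inside-region {x} {y} {z} a≤x z≤b xyz@(xy , yz , xz) =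
      ∈-filter⁺ (λ w → T? (meets N T a b w))
        (∈-liftTris⁺ (4 * N) (fin x y z) (inWindow-fin (≤-<-trans x≤b (<-≤-trans b<4N ≤-refl)) xyz) (IsTriangle⇒isTri xyz))
        (≡true⇒T (∨-≡true⁺ˡ (∧-≡true⁺ (⇒inI a≤x x≤b) (∧-≡true⁺ (⇒inI a≤y y≤b) (⇒inI a≤z z≤b)))))
      where
      x≤b = ≤-trans (<⇒≤ (<-trans (edge< xy) (edge< yz))) z≤b
      a≤y = ≤-trans a≤x (<⇒≤ (edge< xy))
      y≤b = ≤-trans (<⇒≤ (edge< yz)) z≤b
      a≤z = ≤-trans a≤y (<⇒≤ (edge< yz))

    pos∈points⁻ : ∀ {p} → p ∈ points → ∃ λ v → p ≡ pos v × a < v × v < b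
    pos∈points⁻ p∈ with v , v∈ , refl ← ∈-map⁻ pos p∈ = v , refl , ∈-range⁻ v∈

    pos∈points⁺ : ∀ {v} → a < v → v < b → pos v ∈ points
    pos∈points⁺ a<v v<b = ∈-map⁺ pos (∈-range⁺ a<v v<b)

    owningTriangle : ∀ {v} → a < v → v < b → ∃ λ x → ∃ λ z → IsTriangle x v z ×
      fin x v z ∈ regions × pos v ∈ piecePts N T a b (fin x v z)
    owningTriangle a<v v<b with x , z , a≤x , x<v , v<z , z≤b , xvz ← middleTriangle ab a<v v<b =
      x , z , xvz , inside-region a≤x z≤b xvz ,
      pos∈piecePts⁺ {t = fin x _ z} (there (here refl)) (<⇒≤ (≤-<-trans a≤x x<v)) (<⇒≤ (<-≤-trans v<z z≤b))

    open UniqueMatching (piecePts N T a b) apex triWidth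

    owner : ∀ {p} → p ∈ points → ∃ λ t → t ∈ regions × apex t ≡ p × p ∈ piecePts N T a b t
    owner p∈ with v , refl , a<v , v<b ← pos∈points⁻ p∈ with x , z , _ , t∈ , v∈t ← owningTriangle a<v v<b =
      fin x v z , t∈ , refl , v∈t

    owner-wider : ∀ {t p} → t ∈ regions → p ∈ points → p ∈ piecePts N T a b t → apex t ≢ p →
      apex t ∈ points × ∃ λ t′ → t′ ∈ regions × apex t′ ≡ p × triWidth t < triWidth t′
    owner-wider t∈ p∈ p∈t apex≢p
      with v , refl , a<v , v<b ← pos∈points⁻ p∈
      with x′ , y′ , z′ , refl , a≤x′ , z′≤b , x′y′z′ ← region-inside t∈
      with v∈t , _ ← pos∈piecePts⁻ {a} {b} {t = fin x′ y′ z′} p∈t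
      with x , z , xvz , t∈′ , _ ← owningTriangle a<v v<b =
      pos∈points⁺ (≤-<-trans a≤x′ (edge< (proj₁ x′y′z′))) (<-≤-trans (edge< (proj₁ (proj₂ x′y′z′))) z′≤b) ,
      fin x v z , t∈′ , refl , narrower (∈-finVerts-fin v∈t)
      where
      narrower : v ≡ x′ ⊎ v ≡ y′ ⊎ v ≡ z′ → width x′ z′ < width x z
      narrower (inj₁ refl) = leftCorner-narrower xvz x′y′z′
      narrower (inj₂ (inj₁ refl)) = contradiction refl apex≢p
      narrower (inj₂ (inj₂ refl)) = rightCorner-narrower xvz x′y′z′

    apex-injective : ∀ {t t′} → t ∈ regions → t′ ∈ regions → apex t ≡ apex t′ → apex t ∈ points → t ≡ t′
    apex-injective t∈ t′∈ same _
      with x , y , z , refl , _ , _ , xyz ← region-inside t∈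
      with x′ , y′ , z′ , refl , _ , _ , x′yz′ ← region-inside t′∈
      with refl ← same
      with refl , refl ← middleTriangle-unique xyz x′yz′ = refl

    ownership : Ownership points regions
    ownership = record { owner = owner ; owner-wider = owner-wider ; apex-injective = apex-injective }

    unique-matching : matchCount points (map (piecePts N T a b) regions) ≡ 1
    unique-matching = ownership⇒matchCount≡1
      (Unique.map⁺ (λ { refl → refl }) (unique-range (suc a) b))
      (Unique.filter⁺ (λ w → T? (meets N T a b w)) (unique-liftTris (4 * N)))
      ownership

  -- P(i) lifts to the fan between the consecutive rays at p and r; the
  -- triangle with the puncture is owned by r, the others by their middle vertex.
  module Fan {p r} (p-ray : IsRay p) (p<r : p < r) (r≤p+N : r ≤ p + N) (r-ray : IsRay r)
             (no-ray : ∀ {v} → p < v → v < r → ¬ IsRay v) (r<4N : r < 4 * N) where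

    pr : IsEdge p r
    pr with m≤n⇒m<n∨m≡n p<r
    ... | inj₂ eq = inj₁ eq
    ... | inj₁ 1+p<r = inj₂ (p<r , 2≤ , ≤N , uncrossed⇒arc p<r 2≤ ≤N uncrossed)
      where
      2≤ : 2 ≤ r ∸ p
      2≤ = m+n≤o⇒m≤o∸n 2 1+p<r
      ≤N : r ∸ p ≤ N
      ≤N = ≤-trans (∸-monoˡ-≤ p r≤p+N) (≤-reflexive (m+n∸m≡n p N))
      uncrossed : Uncrossed p r
      uncrossed d = noEdge , noRay
        where
        noEdge : ∀ {u v} → IsEdge u v → ¬ Interleave N (p + d * N) (r + d * N) u v
        noEdge uv (inj₁ (_ , u<r , r<v)) = edge-ray-noncrossing uv (IsRay-+* d r-ray) (u<r , r<v)
        noEdge uv (inj₂ (u<p , p<v , _)) = edge-ray-noncrossing uv (IsRay-+* d p-ray) (u<p , p<v)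
        noRay : ∀ {w} → IsRay w → ¬ (p + d * N < w × w < r + d * N)
        noRay {w} w-ray (p<w , w<r) =
          no-ray (+-cancelʳ-< (d * N) p w₀ (subst (p + d * N <_) w≡ p<w))
                 (+-cancelʳ-< (d * N) w₀ r (subst (_< r + d * N) w≡ w<r))
                 (IsRay-∸* d (subst IsRay w≡ w-ray))
          where
          w₀ = w ∸ d * N
          w≡ : w ≡ w₀ + d * N
          w≡ = sym (m∸n+n≡m (≤-trans (m≤n+m (d * N) p) (<⇒≤ p<w)))

    regions : List LTri
    regions = filterᵇ (allIn N T p r) (liftTris N T (4 * N))

    points : List Pt
    points = map pos (filterᵇ (λ v → 𝔹.not (v ≡ᵇ p)) (range p (suc r)))

    apex : LTri → Pt
    apex (fin x y z) = pos y
    apex (inf x y) = pos y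

    triWidth : LTri → ℕ
    triWidth (fin x y z) = width x z
    triWidth (inf x y) = suc N

    Inside : LTri → Set
    Inside t = (∃ λ x → ∃ λ y → ∃ λ z → t ≡ fin x y z × p ≤ x × z ≤ r × IsTriangle x y z) ⊎ t ≡ inf p r

    allIn⇒Inside : ∀ t → allIn N T p r t ≡ true → isTri N T t ≡ true → Inside t
    allIn⇒Inside (fin x y z) allIn-t isTri-t
      with inx , eq₁ ← ∧-≡true⁻ {inI N T p r x} allIn-t
      with _ , eq₂ ← ∧-≡true⁻ {inI N T p r y} eq₁
      with inz , _ ← ∧-≡true⁻ {inI N T p r z} eq₂ =
      inj₁ (x , y , z , refl , proj₁ (inI⇒ {p} {r} inx) , proj₂ (inI⇒ {p} {r} inz) , isTri⇒IsTriangle isTri-t)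
    allIn⇒Inside (inf x y) allIn-t isTri-t
      with inx , eq₁ ← ∧-≡true⁻ {inI N T p r x} allIn-t
      with iny , _ ← ∧-≡true⁻ {inI N T p r y} eq₁
      with xy , x-ray , y-ray ← isTri-inf⇒ isTri-t
      with p≤x , _ ← inI⇒ {p} {r} inx
      with _ , y≤r ← inI⇒ {p} {r} iny = inj₂ (cong₂ inf x≡p y≡r)
      where
      x≡p : x ≡ p
      x≡p with m≤n⇒m<n∨m≡n p≤x
      ... | inj₂ eq = sym eq
      ... | inj₁ p<x = contradiction x-ray (no-ray p<x (<-≤-trans (edge< xy) y≤r))
      y≡r : y ≡ r
      y≡r with m≤n⇒m<n∨m≡n y≤r
      ... | inj₂ eq = eq
      ... | inj₁ y<r = contradiction y-ray (no-ray (≤-<-trans p≤x (edge< xy)) y<r)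

    region-inside : ∀ {t} → t ∈ regions → Inside t
    region-inside {t} t∈ with t∈lift , allIn-t ← ∈-filter⁻ (λ w → T? (allIn N T p r w)) {xs = liftTris N T (4 * N)} t∈ =
      allIn⇒Inside t (T⇒≡true allIn-t) (proj₂ (∈-liftTris⁻ (4 * N) t t∈lift))

    inside-region : ∀ {x y z} → p ≤ x → z ≤ r → IsTriangle x y z → fin x y z ∈ regions
    inside-region {x} {y} {z} p≤x z≤r xyz@(xy , yz , xz) =
      ∈-filter⁺ (λ w → T? (allIn N T p r w))
        (∈-liftTris⁺ (4 * N) (fin x y z) (inWindow-fin (≤-<-trans x≤r r<4N) xyz) (IsTriangle⇒isTri xyz))
        (≡true⇒T (∧-≡true⁺ (⇒inI p≤x x≤r) (∧-≡true⁺ (⇒inI p≤y y≤r) (∧-≡true⁺ (⇒inI p≤z z≤r) refl))))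
      where
      x≤r = ≤-trans (<⇒≤ (<-trans (edge< xy) (edge< yz))) z≤r
      p≤y = ≤-trans p≤x (<⇒≤ (edge< xy))
      y≤r = ≤-trans (<⇒≤ (edge< yz)) z≤r
      p≤z = ≤-trans p≤y (<⇒≤ (edge< yz))

    puncturedTriangle : inf p r ∈ regions
    puncturedTriangle =
      ∈-filter⁺ (λ w → T? (allIn N T p r w))
        (∈-liftTris⁺ (4 * N) (inf p r) (<-trans p<r r<4N , p<r , r≤p+N)
          (∧-≡true⁺ (<⇒<ᵇ-true p<r) (∧-≡true⁺ (IsEdge⇒Edge pr) (∧-≡true⁺ p-ray r-ray))))
        (≡true⇒T (∧-≡true⁺ (⇒inI ≤-refl (<⇒≤ p<r)) (∧-≡true⁺ (⇒inI (<⇒≤ p<r) ≤-refl) refl)))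

    pos∈points⁻ : ∀ {q} → q ∈ points → ∃ λ v → q ≡ pos v × p < v × v ≤ r
    pos∈points⁻ q∈
      with v , v∈ , refl ← ∈-map⁻ pos q∈
      with v∈range , v≢p ← ∈-filter⁻ (λ w → T? (𝔹.not (w ≡ᵇ p))) {xs = range p (suc r)} v∈
      with p≤v , v<1+r ← ∈-range⁻ {p} {suc r} v∈range =
      v , refl , ≤∧≢⇒< p≤v (λ { refl → v≢p′ (≡⇒≡ᵇ-true {p} refl) (T⇒≡true v≢p) }) , ≤-pred v<1+r
      where
      v≢p′ : ∀ {b} → b ≡ true → 𝔹.not b ≡ true → ⊥
      v≢p′ refl ()

    pos∈points⁺ : ∀ {v} → p < v → v ≤ r → pos v ∈ points
    pos∈points⁺ {v} p<v v≤r =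
      ∈-map⁺ pos (∈-filter⁺ (λ w → T? (𝔹.not (w ≡ᵇ p))) (∈-range⁺ (<⇒≤ p<v) (s≤s v≤r)) (≡true⇒T (v≢p (v ≡ᵇ p) refl)))
      where
      v≢p : ∀ b → b ≡ (v ≡ᵇ p) → 𝔹.not b ≡ true
      v≢p true eq = contradiction (≡ᵇ-true⇒≡ (sym eq)) (>⇒≢ p<v)
      v≢p false _ = refl

    owningTriangle : ∀ {v} → p < v → v < r → ∃ λ x → ∃ λ z → fin x v z ∈ regions × IsTriangle x v z
    owningTriangle p<v v<r with x , z , p≤x , _ , _ , z≤r , xvz ← middleTriangle pr p<v v<r = x , z , inside-region p≤x z≤r xvz , xvz

    ∈-posCorners-fin : ∀ {v x y z} → pos v ∈ posCorners N T (fin x y z) → v ≡ x ⊎ v ≡ y ⊎ v ≡ z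
    ∈-posCorners-fin (here refl) = inj₁ refl
    ∈-posCorners-fin (there (here refl)) = inj₂ (inj₁ refl)
    ∈-posCorners-fin (there (there (here refl))) = inj₂ (inj₂ refl)

    ∈-posCorners-inf : ∀ {v x y} → pos v ∈ posCorners N T (inf x y) → v ≡ x ⊎ v ≡ y
    ∈-posCorners-inf (here refl) = inj₁ refl
    ∈-posCorners-inf (there (here refl)) = inj₂ refl
    ∈-posCorners-inf (there (there (here ())))

    open UniqueMatching (posCorners N T) apex triWidth

    owner : ∀ {q} → q ∈ points → ∃ λ t → t ∈ regions × apex t ≡ q × q ∈ posCorners N T t
    owner q∈ with v , refl , p<v , v≤r ← pos∈points⁻ q∈ with m≤n⇒m<n∨m≡n v≤r
    ... | inj₂ refl = inf p v , puncturedTriangle , refl , there (here refl)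
    ... | inj₁ v<r with x , z , t∈ , _ ← owningTriangle p<v v<r = fin x v z , t∈ , refl , there (here refl)

    owner-wider : ∀ {t q} → t ∈ regions → q ∈ points → q ∈ posCorners N T t → apex t ≢ q →
      apex t ∈ points × ∃ λ t′ → t′ ∈ regions × apex t′ ≡ q × triWidth t < triWidth t′
    owner-wider t∈ q∈ q∈t apex≢q with pos∈points⁻ q∈ | region-inside t∈
    ... | v , refl , p<v , _ | inj₂ refl with ∈-posCorners-inf {v} {p} {r} q∈t
    ...   | inj₁ refl = contradiction p<v (<-irrefl refl)
    ...   | inj₂ refl = contradiction refl apex≢q
    owner-wider t∈ q∈ q∈t apex≢q | v , refl , p<v , v≤r | inj₁ (x′ , y′ , z′ , refl , p≤x′ , z′≤r , x′y′z′@(x′y′ , y′z′ , x′z′)) =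
      pos∈points⁺ (≤-<-trans p≤x′ (edge< x′y′)) (<⇒≤ (<-≤-trans (edge< y′z′) z′≤r)) , wider (∈-posCorners-fin q∈t)
      where
      wider : v ≡ x′ ⊎ v ≡ y′ ⊎ v ≡ z′ → ∃ λ t′ → t′ ∈ regions × apex t′ ≡ pos v × width x′ z′ < triWidth t′
      wider (inj₂ (inj₁ refl)) = contradiction refl apex≢q
      wider (inj₁ refl) with x , z , t∈′ , xvz ← owningTriangle p<v (<-≤-trans (<-trans (edge< x′y′) (edge< y′z′)) z′≤r) =
        fin x v z , t∈′ , refl , leftCorner-narrower xvz x′y′z′
      wider (inj₂ (inj₂ refl)) with m≤n⇒m<n∨m≡n v≤r
      ... | inj₁ v<r with x , z , t∈′ , xvz ← owningTriangle p<v v<r = fin x v z , t∈′ , refl , rightCorner-narrower xvz x′y′z′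
      ... | inj₂ refl = inf p v , puncturedTriangle , refl , s≤s (edge-length≤N x′z′)

    apex-injective : ∀ {t t′} → t ∈ regions → t′ ∈ regions → apex t ≡ apex t′ → apex t ∈ points → t ≡ t′
    apex-injective t∈ t′∈ same _ with region-inside t∈ | region-inside t′∈
    ... | inj₁ (_ , _ , _ , refl , _ , _ , xyz) | inj₁ (_ , _ , _ , refl , _ , _ , x′yz′) with refl ← same
        with refl , refl ← middleTriangle-unique xyz x′yz′ = refl
    ... | inj₁ (_ , _ , _ , refl , _ , z≤r , (_ , yz , _)) | inj₂ refl with refl ← same = contradiction z≤r (<⇒≱ (edge< yz))
    ... | inj₂ refl | inj₁ (_ , _ , _ , refl , _ , z≤r , (_ , yz , _)) with refl ← same = contradiction z≤r (<⇒≱ (edge< yz))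
    ... | inj₂ refl | inj₂ refl = refl

    ownership : Ownership points regions
    ownership = record { owner = owner ; owner-wider = owner-wider ; apex-injective = apex-injective }

    unique-matching : matchCount points (map (posCorners N T) regions) ≡ 1
    unique-matching = ownership⇒matchCount≡1
      (Unique.map⁺ (λ { refl → refl }) (Unique.filter⁺ (λ w → T? (𝔹.not (w ≡ᵇ p))) (unique-range p (suc r))))
      (Unique.filter⁺ (λ w → T? (allIn N T p r w)) (unique-liftTris (4 * N)))
      ownership

  -- With D_ii in T, one lift of every triangle of T fits in the polygon under
  -- the lift [p, p + N] of D_ii, where p is the lift of i; the self-folded
  -- triangle (p, p + N, ∞) owns the puncture.
  module Loop (i : Fin N) (Tii : T (dArc i i) ≡ true) where

    p = toℕ i

    p<N : p < N
    p<N = toℕ<n i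

    loopEdge : IsEdge p (p + N)
    loopEdge = subst₂ IsEdge (+-identityʳ p) (trans (+-identityʳ _) (cong (p +_) (len-self i))) (arc⇒IsEdge Tii 0)

    p%N : p % N ≡ p
    p%N = m<n⇒m%n≡m p<N

    [p+N]%N : (p + N) % N ≡ p
    [p+N]%N = trans ([m+n]%n≡m%n p N) p%N

    interior-lab≢i : ∀ {v} → p < v → v < p + N → lab N v ≢ i
    interior-lab≢i p<v v<p+N eq = %-injective-window p<v v<p+N (trans p%N (trans (sym (cong toℕ eq)) (toℕ-lab _)))

    interiorLift : ∀ (k : Fin N) → k ≢ i → ∃ λ v → p < v × v < p + N × v % N ≡ toℕ k
    interiorLift k k≢i with <-cmp (toℕ k) p
    ... | tri≈ _ eq _ = contradiction (toℕ-injective eq) k≢i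
    ... | tri> _ _ p<k = toℕ k , p<k , <-≤-trans (toℕ<n k) (m≤n+m N p) , m<n⇒m%n≡m (toℕ<n k)
    ... | tri< k<p _ _ = toℕ k + N , <-≤-trans p<N (m≤n+m N (toℕ k)) , +-monoˡ-< N k<p ,
                        trans ([m+n]%n≡m%n (toℕ k) N) (m<n⇒m%n≡m (toℕ<n k))

    ray⇒lab≡i : ∀ {w} → IsRay w → lab N w ≡ i
    ray⇒lab≡i {w} w-ray with lab N w Fin.≟ i
    ... | yes eq = eq
    ... | no lab≢i with v , p<v , v<p+N , v%N ← interiorLift (lab N w) lab≢i =
      contradiction (p<v , v<p+N)
        (edge-ray-noncrossing loopEdge (subst (λ k → T (cArc k) ≡ true) (sym (lab-cong (trans v%N (toℕ-lab w)))) w-ray))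

    -- D_i0 crosses no arc, since every arc lies under a lift of D_ii.
    centralArc : T (cArc i) ≡ true
    centralArc = maximal (cArc i) tt noCross
      where
      noCross : ∀ b → T b ≡ true → ¬ Cross N (cArc i) b
      noCross (dArc k l) Tkl (s , t , k<i , i<l) =
        edges-noncrossing (IsEdge-+* t loopEdge) (arc⇒IsEdge Tkl s) (inj₂ (k<i , i<l , l<i+N))
        where
        l<i+N : toℕ k + len N k l + s * N < toℕ i + N + t * N
        l<i+N = subst₂ _<_
          (sym (trans (+-assoc (toℕ k) _ _) (trans (cong (toℕ k +_) (+-comm (len N k l) _)) (sym (+-assoc (toℕ k) _ _)))))
          (trans (+-assoc (toℕ i) _ _) (trans (cong (toℕ i +_) (+-comm (t * N) N)) (sym (+-assoc (toℕ i) _ _))))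
          (+-mono-<-≤ k<i (len≤N k l))

    p-ray : IsRay p
    p-ray = subst (λ k → T (cArc k) ≡ true) (sym (lab-toℕ i)) centralArc

    edge-below-loop : ∀ {x z} → p ≤ x → x < p + N → IsEdge x z → z ≤ p + N
    edge-below-loop {x} {z} p≤x x<p+N xz with m≤n⇒m<n∨m≡n p≤x
    ... | inj₂ refl = edge≤+N xz
    ... | inj₁ p<x with <-cmp z (p + N)
    ... | tri< z< _ _ = <⇒≤ z<
    ... | tri≈ _ eq _ = ≤-reflexive eq
    ... | tri> _ _ z> = contradiction (inj₁ (p<x , x<p+N , z>)) (edges-noncrossing loopEdge xz)

    regions : List LTri
    regions = trisT N T

    points : List Pt
    points = map (λ k → pos (toℕ k)) (filter (λ k → ¬? (k Fin.≟ i)) (allFin N)) ++ punct ∷ []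

    apex : LTri → Pt
    apex (fin x y z) = pos (y % N)
    apex (inf x y) = punct

    triWidth : LTri → ℕ
    triWidth (fin x y z) = width x z
    triWidth (inf x y) = 0

    inf-region : ∀ {x y} → inf x y ∈ regions → x ≡ p × y ≡ p + N
    inf-region {x} {y} t∈
      with (x<N , x<y , y≤x+N) , isTri-t ← ∈-liftTris⁻ N (inf x y) t∈
      with _ , x-ray , y-ray ← isTri-inf⇒ isTri-t = x≡p , y≡p+N
      where
      x≡p : x ≡ p
      x≡p = trans (sym (m<n⇒m%n≡m x<N)) (trans (sym (toℕ-lab x)) (cong toℕ (ray⇒lab≡i x-ray)))
      y≡p+N : y ≡ p + N
      y≡p+N with <-cmp y (p + N)
      ... | tri≈ _ eq _ = eq
      ... | tri> _ _ y> = contradiction y≤x+N (<⇒≱ (subst (λ w → w + N < y) (sym x≡p) y>))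
      ... | tri< y< _ _ = contradiction (ray⇒lab≡i y-ray) (interior-lab≢i (subst (_< y) x≡p x<y) y<)

    puncturedTriangle : inf p (p + N) ∈ regions
    puncturedTriangle = ∈-liftTris⁺ N (inf p (p + N)) (p<N , m<m+n p 1≤N , ≤-refl)
      (∧-≡true⁺ (<⇒<ᵇ-true (edge< loopEdge)) (∧-≡true⁺ (IsEdge⇒Edge loopEdge)
        (∧-≡true⁺ p-ray (subst (λ k → T (cArc k) ≡ true) (sym (lab-+N p)) p-ray))))

    polygonTriangle⇒region : ∀ {x y z} → p ≤ x → z ≤ p + N → IsTriangle x y z → ∃ λ t → t ∈ regions ×
      apex t ≡ pos (y % N) × labCorners N T t ≡ pos (x % N) ∷ pos (y % N) ∷ pos (z % N) ∷ [] × triWidth t ≡ width x z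
    polygonTriangle⇒region {x} {y} {z} p≤x z≤p+N xyz@(xy , yz , xz) with x <? N
    ... | yes x<N = fin x y z , ∈-liftTris⁺ N (fin x y z) (inWindow-fin x<N xyz) (IsTriangle⇒isTri xyz) , refl , refl , refl
    ... | no x≮N = fin x₀ y₀ z₀ , ∈-liftTris⁺ N (fin x₀ y₀ z₀) (inWindow-fin x₀<N x₀y₀z₀) (IsTriangle⇒isTri x₀y₀z₀) ,
                   cong pos (down-% y≡) , cong₂ _∷_ (cong pos (down-% x≡)) (cong₂ _∷_ (cong pos (down-% y≡)) (cong₂ _∷_ (cong pos (down-% z≡)) refl)) ,
                   trans (sym (+-∸-shift x₀ z₀ N)) (cong₂ _∸_ (sym z≡) (sym x≡))
      where
      N≤x = ≮⇒≥ x≮N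
      N≤y = ≤-trans N≤x (<⇒≤ (edge< xy))
      N≤z = ≤-trans N≤y (<⇒≤ (edge< yz))
      x₀ = x ∸ N
      y₀ = y ∸ N
      z₀ = z ∸ N
      x≡ : x ≡ x₀ + N
      x≡ = sym (m∸n+n≡m N≤x)
      y≡ : y ≡ y₀ + N
      y≡ = sym (m∸n+n≡m N≤y)
      z≡ : z ≡ z₀ + N
      z≡ = sym (m∸n+n≡m N≤z)
      down : ∀ {u v u₀ v₀} → u ≡ u₀ + N → v ≡ v₀ + N → IsEdge u v → IsEdge u₀ v₀
      down {u₀ = u₀} {v₀} refl refl uv =
        IsEdge-∸* 1 (subst₂ IsEdge (cong (u₀ +_) (sym (+-identityʳ N))) (cong (v₀ +_) (sym (+-identityʳ N))) uv)
      x₀y₀z₀ : IsTriangle x₀ y₀ z₀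
      x₀y₀z₀ = down x≡ y≡ xy , down y≡ z≡ yz , down x≡ z≡ xz
      x₀<N : x₀ < N
      x₀<N = +-cancelʳ-< N x₀ N (subst (_< N + N) x≡ (<-≤-trans (edge< xz) (≤-trans z≤p+N (<⇒≤ (+-monoˡ-< N p<N)))))
      down-% : ∀ {w w₀} → w ≡ w₀ + N → w₀ % N ≡ w % N
      down-% {w} {w₀} w≡ = trans (sym ([m+n]%n≡m%n w₀ N)) (cong (_% N) (sym w≡))

    IsShift : ℕ → Set
    IsShift sh = sh ≡ 0 ⊎ sh ≡ N

    Placement : ℕ → ℕ → ℕ → Set
    Placement x y z = ∃ λ sh → IsShift sh × p ≤ x + sh × z + sh ≤ p + N × IsTriangle (x + sh) (y + sh) (z + sh)

    unshifted : ∀ {x y z} → z ≤ p + N → IsTriangle x y z → z + 0 ≤ p + N × IsTriangle (x + 0) (y + 0) (z + 0)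
    unshifted {x} {y} {z} z≤ xyz rewrite +-identityʳ x | +-identityʳ y | +-identityʳ z = z≤ , xyz

    region-placement : ∀ {x y z} → fin x y z ∈ regions → x < N × Placement x y z
    region-placement {x} {y} {z} t∈
      with (x<N , _) , isTri-t ← ∈-liftTris⁻ N (fin x y z) t∈
      with xyz@(xy , yz , xz) ← isTri⇒IsTriangle isTri-t
      with <-cmp x p
    ... | tri< x<p _ _ = x<N , N , inj₂ refl , p≤x+N , edge-below-loop p≤x+N (+-monoˡ-< N x<p) (up xz) , up xy , up yz , up xz
      where
      p≤x+N = ≤-trans (<⇒≤ p<N) (m≤n+m N x)
      up : ∀ {u v} → IsEdge u v → IsEdge (u + N) (v + N)
      up {u} {v} uv = subst₂ IsEdge (cong (u +_) (+-identityʳ N)) (cong (v +_) (+-identityʳ N)) (IsEdge-+* 1 uv)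
    ... | tri≈ _ refl _ = x<N , 0 , inj₁ refl , ≤-reflexive (sym (+-identityʳ x)) , unshifted (edge-below-loop ≤-refl (<-≤-trans x<N (m≤n+m N p)) xz) xyz
    ... | tri> _ _ p<x = x<N , 0 , inj₁ refl , ≤-trans (<⇒≤ p<x) (≤-reflexive (sym (+-identityʳ x))) , unshifted (edge-below-loop (<⇒≤ p<x) (<-≤-trans x<N (m≤n+m N p)) xz) xyz

    otherVertices : List (Fin N)
    otherVertices = filter (λ k → ¬? (k Fin.≟ i)) (allFin N)

    points⁻ : ∀ {q} → q ∈ points → (∃ λ k → k ≢ i × q ≡ pos (toℕ k)) ⊎ q ≡ punct
    points⁻ q∈ with ∈-++⁻ (map (λ k → pos (toℕ k)) otherVertices) q∈
    ... | inj₂ (here eq) = inj₂ eq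
    ... | inj₁ q∈′ with k , k∈ , eq ← ∈-map⁻ (λ k → pos (toℕ k)) q∈′ =
      inj₁ (k , proj₂ (∈-filter⁻ (λ k → ¬? (k Fin.≟ i)) {xs = allFin N} k∈) , eq)

    interior∈points : ∀ {y} → p < y → y < p + N → pos (y % N) ∈ points
    interior∈points {y} p<y y<p+N = subst (_∈ points) (cong pos (toℕ-lab y))
      (∈-++⁺ˡ (∈-map⁺ (λ k → pos (toℕ k)) (∈-filter⁺ (λ k → ¬? (k Fin.≟ i)) (∈-allFin _) (interior-lab≢i p<y y<p+N))))

    unique-points : Unique points
    unique-points = Unique.++⁺ (Unique.map⁺ (toℕ-injective ∘ pos-injective) (Unique.filter⁺ (λ k → ¬? (k Fin.≟ i)) (Unique.allFin⁺ N)))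
                               (All.[] ∷ []) punct∉
      where
      punct∉ : ∀ {q} → ¬ (q ∈ map (λ k → pos (toℕ k)) otherVertices × q ∈ punct ∷ [])
      punct∉ (q∈ , here refl) with _ , _ , () ← ∈-map⁻ (λ k → pos (toℕ k)) q∈

    %-injective-interior : ∀ {u v} → p < u → u < p + N → p < v → v < p + N → u % N ≡ v % N → u ≡ v
    %-injective-interior {u} {v} p<u u<p+N p<v v<p+N eq with <-cmp u v
    ... | tri≈ _ u≡v _ = u≡v
    ... | tri< u<v _ _ = contradiction eq (%-injective-window u<v (<-trans v<p+N (+-monoˡ-< N p<u)))
    ... | tri> _ _ v<u = contradiction (sym eq) (%-injective-window v<u (<-trans u<p+N (+-monoˡ-< N p<v)))

    shift-% : ∀ {w sh} → IsShift sh → (w + sh) % N ≡ w % N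
    shift-% {w} (inj₁ refl) = cong (_% N) (+-identityʳ w)
    shift-% {w} (inj₂ refl) = [m+n]%n≡m%n w N

    shift-injective : ∀ {x x′ sh sh′} → x < N → x′ < N → IsShift sh → IsShift sh′ → x + sh ≡ x′ + sh′ → x ≡ x′ × sh ≡ sh′
    shift-injective {x} {x′} _ _ (inj₁ refl) (inj₁ refl) eq = +-cancelʳ-≡ 0 x x′ eq , refl
    shift-injective {x} {x′} _ _ (inj₂ refl) (inj₂ refl) eq = +-cancelʳ-≡ N x x′ eq , refl
    shift-injective {x} {x′} x<N _ (inj₁ refl) (inj₂ refl) eq =
      contradiction (subst (N ≤_) (trans (sym eq) (+-identityʳ x)) (m≤n+m N x′)) (<⇒≱ x<N)
    shift-injective {x} {x′} _ x′<N (inj₂ refl) (inj₁ refl) eq =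
      contradiction (subst (N ≤_) (trans eq (+-identityʳ x′)) (m≤n+m N x)) (<⇒≱ x′<N)

    owningTriangle : ∀ {v} → p < v → v < p + N → ∃ λ x → ∃ λ z → IsTriangle x v z × ∃ λ t → t ∈ regions ×
      apex t ≡ pos (v % N) × labCorners N T t ≡ pos (x % N) ∷ pos (v % N) ∷ pos (z % N) ∷ [] × triWidth t ≡ width x z
    owningTriangle p<v v<p+N with x , z , p≤x , _ , _ , z≤ , xvz ← middleTriangle loopEdge p<v v<p+N =
      x , z , xvz , polygonTriangle⇒region p≤x z≤ xvz

    ∈-three : ∀ {q a b c : Pt} → q ∈ a ∷ b ∷ c ∷ [] → q ≡ a ⊎ q ≡ b ⊎ q ≡ c
    ∈-three (here eq) = inj₁ eq
    ∈-three (there (here eq)) = inj₂ (inj₁ eq)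
    ∈-three (there (there (here eq))) = inj₂ (inj₂ eq)

    open UniqueMatching (labCorners N T) apex triWidth

    k≢i⇒toℕ≢p : ∀ {k} → k ≢ i → toℕ k ≢ p
    k≢i⇒toℕ≢p k≢i eq = k≢i (toℕ-injective eq)

    owner : ∀ {q} → q ∈ points → ∃ λ t → t ∈ regions × apex t ≡ q × q ∈ labCorners N T t
    owner q∈ with points⁻ q∈
    ... | inj₂ refl = inf p (p + N) , puncturedTriangle , refl , there (there (here refl))
    ... | inj₁ (k , k≢i , refl)
      with v , p<v , v<p+N , v%N ← interiorLift k k≢i
      with _ , _ , _ , t , t∈ , apex-t , corners-t , _ ← owningTriangle p<v v<p+N =
      t , t∈ , trans apex-t (cong pos v%N) , subst (pos (toℕ k) ∈_) (sym corners-t) (there (here (cong pos (sym v%N))))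

    owner-wider : ∀ {t q} → t ∈ regions → q ∈ points → q ∈ labCorners N T t → apex t ≢ q →
      apex t ∈ points × ∃ λ t′ → t′ ∈ regions × apex t′ ≡ q × triWidth t < triWidth t′
    owner-wider {inf x y} t∈ q∈ q∈t apex≢q with inf-region t∈ | points⁻ q∈
    ... | _ | inj₂ refl = contradiction refl apex≢q
    ... | refl , refl | inj₁ (k , k≢i , refl) with ∈-three q∈t
    ... | inj₁ eq = contradiction (trans (pos-injective eq) p%N) (k≢i⇒toℕ≢p k≢i)
    ... | inj₂ (inj₁ eq) = contradiction (trans (pos-injective eq) [p+N]%N) (k≢i⇒toℕ≢p k≢i)
    ... | inj₂ (inj₂ ())
    owner-wider {fin x y z} t∈ q∈ q∈t apex≢q with region-placement t∈ | points⁻ q∈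
    ... | _ | inj₂ refl with ∈-three q∈t
    ...   | inj₁ () 
    ...   | inj₂ (inj₁ ())
    ...   | inj₂ (inj₂ ())
    owner-wider {fin x y z} t∈ q∈ q∈t apex≢q | _ , sh , shift , p≤X , Z≤ , XYZ@(XY , YZ , XZ) | inj₁ (k , k≢i , refl) =
      subst (_∈ points) (cong pos (shift-% {y} shift)) (interior∈points p<Y Y<p+N) , wider (∈-three q∈t)
      where
      p<Y = ≤-<-trans p≤X (edge< XY)
      Y<p+N = <-≤-trans (edge< YZ) Z≤
      width≡ : width x z ≡ width (x + sh) (z + sh)
      width≡ = sym (+-∸-shift x z sh)
      wider : pos (toℕ k) ≡ pos (x % N) ⊎ pos (toℕ k) ≡ pos (y % N) ⊎ pos (toℕ k) ≡ pos (z % N) →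
        ∃ λ t′ → t′ ∈ regions × apex t′ ≡ pos (toℕ k) × width x z < triWidth t′
      wider (inj₂ (inj₁ eq)) = contradiction (sym eq) apex≢q
      wider (inj₁ eq) with m≤n⇒m<n∨m≡n p≤X
      ... | inj₂ p≡X = contradiction (trans (pos-injective eq) (trans (sym (shift-% {x} shift)) (trans (cong (_% N) (sym p≡X)) p%N)))
                                     (k≢i⇒toℕ≢p k≢i)
      ... | inj₁ p<X with _ , _ , x′Xz′ , t′ , t′∈ , apex-t′ , _ , width-t′ ← owningTriangle p<X (<-trans (edge< XY) Y<p+N) =
        t′ , t′∈ , trans apex-t′ (cong pos (trans (shift-% {x} shift) (sym (pos-injective eq)))) ,
        subst₂ _<_ (sym width≡) (sym width-t′) (leftCorner-narrower x′Xz′ XYZ)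
      wider (inj₂ (inj₂ eq)) with m≤n⇒m<n∨m≡n Z≤
      ... | inj₂ Z≡ = contradiction (trans (pos-injective eq) (trans (sym (shift-% {z} shift)) (trans (cong (_% N) Z≡) [p+N]%N)))
                                    (k≢i⇒toℕ≢p k≢i)
      ... | inj₁ Z< with _ , _ , x′Zz′ , t′ , t′∈ , apex-t′ , _ , width-t′ ← owningTriangle (<-trans p<Y (edge< YZ)) Z< =
        t′ , t′∈ , trans apex-t′ (cong pos (trans (shift-% {z} shift) (sym (pos-injective eq)))) ,
        subst₂ _<_ (sym width≡) (sym width-t′) (rightCorner-narrower x′Zz′ XYZ)

    apex-injective : ∀ {t t′} → t ∈ regions → t′ ∈ regions → apex t ≡ apex t′ → apex t ∈ points → t ≡ t′
    apex-injective {inf _ _} {inf _ _} t∈ t′∈ _ _ with refl , refl ← inf-region t∈ with refl , refl ← inf-region t′∈ = refl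
    apex-injective {fin x y z} {fin x′ y′ z′} t∈ t′∈ same _
      with x<N , sh , shift , p≤X , Z≤ , XYZ ← region-placement t∈
      with x′<N , sh′ , shift′ , p≤X′ , Z′≤ , XYZ′ ← region-placement t′∈ =
      cong₃ fin x≡x′ (+-cancelʳ-≡ sh y y′ (trans Y≡Y′ (cong (y′ +_) (sym sh≡sh′))))
                     (+-cancelʳ-≡ sh z z′ (trans (proj₂ same-XZ) (cong (z′ +_) (sym sh≡sh′))))
      where
      cong₃ : ∀ (g : ℕ → ℕ → ℕ → LTri) {a b c a′ b′ c′} → a ≡ a′ → b ≡ b′ → c ≡ c′ → g a b c ≡ g a′ b′ c′
      cong₃ g refl refl refl = refl
      Y≡Y′ : y + sh ≡ y′ + sh′
      Y≡Y′ = %-injective-interior (≤-<-trans p≤X (edge< (proj₁ XYZ))) (<-≤-trans (edge< (proj₁ (proj₂ XYZ))) Z≤)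
                                  (≤-<-trans p≤X′ (edge< (proj₁ XYZ′))) (<-≤-trans (edge< (proj₁ (proj₂ XYZ′))) Z′≤)
                                  (trans (shift-% {y} shift) (trans (pos-injective same) (sym (shift-% {y′} shift′))))
      same-XZ = middleTriangle-unique XYZ (subst (λ w → IsTriangle (x′ + sh′) w (z′ + sh′)) (sym Y≡Y′) XYZ′)
      x≡x′ = proj₁ (shift-injective x<N x′<N shift shift′ (proj₁ same-XZ))
      sh≡sh′ = proj₂ (shift-injective x<N x′<N shift shift′ (proj₁ same-XZ))

    ownership : Ownership points regions
    ownership = record { owner = owner ; owner-wider = owner-wider ; apex-injective = apex-injective }

    unique-matching : matchCount points (map (labCorners N T) regions) ≡ 1
    unique-matching = ownership⇒matchCount≡1 unique-points (unique-liftTris N) ownership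

  m-unfold-loop : ∀ i → m N T i i ≡ mLoop N T i
  m-unfold-loop i with i Fin.≟ i
  ... | yes _ = refl
  ... | no i≢i = contradiction refl i≢i

  m-unfold-trunc : ∀ i j → i ≢ j → j ≢ next N i → m N T i j ≡ mTrunc N T i j
  m-unfold-trunc i j i≢j j≢next with i Fin.≟ j | j Fin.≟ next N i
  ... | yes i≡j | _ = contradiction i≡j i≢j
  ... | no _ | yes j≡next = contradiction j≡next j≢next
  ... | no _ | no _ = refl

  3N<4N : ∀ {x} → x < N + N + N → x < 4 * N
  3N<4N x< = <-≤-trans x< (subst (_≤ 4 * N) (trans (cong (N +_) (cong (N +_) (+-identityʳ N))) (sym (+-assoc N N N)))
                                 (*-monoˡ-≤ N {3} {4} (s≤s (s≤s (s≤s z≤n)))))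

  m≡1 : ∀ i j → j ≢ next N i → T (dArc i j) ≡ true → m N T i j ≡ 1
  m≡1 i j j≢next Tij = by-cases (i Fin.≟ j)
    where
    a = toℕ i + N
    by-cases : Dec (i ≡ j) → m N T i j ≡ 1
    by-cases (yes refl) = trans (m-unfold-loop i) (Loop.unique-matching i Tij)
    by-cases (no i≢j) = trans (m-unfold-trunc i j i≢j j≢next) (Truncation.unique-matching ab b<4N)
      where
      ab : IsEdge a (a + len N i j)
      ab = subst₂ IsEdge (cong (toℕ i +_) (+-identityʳ N))
        (trans (cong (toℕ i + len N i j +_) (+-identityʳ N)) (trans (+-assoc (toℕ i) _ _) (trans (cong (toℕ i +_) (+-comm (len N i j) N)) (sym (+-assoc (toℕ i) _ _)))))
        (arc⇒IsEdge Tij 1)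
      b<4N : a + len N i j < 4 * N
      b<4N = 3N<4N (+-mono-<-≤ (+-monoˡ-< N (toℕ<n i)) (len≤N i j))

  searchDown-hit : ∀ {v k} → 1 ≤ k → IsRay v → searchDown N T v k ≡ just v
  searchDown-hit {k = suc k} _ v-ray rewrite v-ray = refl

  FirstRay : ℕ → ℕ → Set
  FirstRay q k = ∃ λ r → searchUp N T q k ≡ just r × q ≤ r × r < q + k × IsRay r × (∀ {v} → q ≤ v → v < r → ¬ IsRay v)

  searchUp-hit : ∀ k q {w} → q ≤ w → w < q + k → IsRay w → FirstRay q k
  searchUp-hit zero q q≤w w<q+0 _ = contradiction (subst (_≤ _) (sym (+-identityʳ q)) q≤w) (<⇒≱ w<q+0)
  searchUp-hit (suc k) q {w} q≤w w< w-ray with Ray N T q in q-ray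
  ... | true = q , refl , ≤-refl , m<m+n q z<s , q-ray , λ q≤v v<q → contradiction q≤v (<⇒≱ v<q)
  ... | false with m≤n⇒m<n∨m≡n q≤w
  ...   | inj₂ refl = contradiction (trans (sym q-ray) w-ray) λ ()
  ...   | inj₁ q<w with r , found , 1+q≤r , r< , r-ray , first ← searchUp-hit k (suc q) q<w (subst (w <_) (+-suc q k) w<) w-ray =
    r , found , <⇒≤ 1+q≤r , subst (r <_) (sym (+-suc q k)) r< , r-ray , first′
    where
    first′ : ∀ {v} → q ≤ v → v < r → ¬ IsRay v
    first′ q≤v v<r with m≤n⇒m<n∨m≡n q≤v
    ... | inj₂ refl = λ v-ray → contradiction (trans (sym q-ray) v-ray) λ ()
    ... | inj₁ q<v = first q<v v<r

  lab-ray : ∀ {v i} → T (cArc i) ≡ true → lab N v ≡ i → IsRay v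
  lab-ray Ti lab≡ = subst (λ k → T (cArc k) ≡ true) (sym lab≡) Ti

  m0≡1 : ∀ i → T (cArc i) ≡ true → m0 N T i ≡ 1
  m0≡1 i Ti
    with r , found , p<r , r< , r-ray , first ←
         searchUp-hit N (suc (toℕ i + N)) (subst (_≤ toℕ i + N + N) (+-comm (toℕ i + N) 1) (+-monoʳ-≤ (toℕ i + N) 1≤N))
                      (s≤s ≤-refl) (lab-ray Ti (trans (lab-+N _) (trans (lab-+N _) (lab-toℕ i))))
    rewrite searchDown-hit {toℕ i + N} {N} 1≤N (lab-ray Ti (trans (lab-+N (toℕ i)) (lab-toℕ i))) | found =
    Fan.unique-matching p-ray p<r (≤-pred r<) r-ray first (3N<4N (≤-<-trans (≤-pred r<) (+-monoˡ-< N (+-monoˡ-< N (toℕ<n i)))))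
    where
    p-ray : IsRay (toℕ i + N)
    p-ray = lab-ray Ti (trans (lab-+N _) (lab-toℕ i))

lemma4p1 : (N : ℕ) → {{_ : NonZero N}} → 3 ≤ N →
    (T : Arc N → Bool) → IsTriangulation N T →
    ((i j : Fin N) → j ≢ next N i → T (dArc i j) ≡ true → m N T i j ≡ 1)
    × ((i : Fin N) → T (cArc i) ≡ true → m0 N T i ≡ 1)
lemma4p1 N _ T triangulation = Cover.m≡1 N T triangulation , Cover.m0≡1 N T triangulation
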